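{- Let $m\ge2$, $\pi$ a partition of $m$ and $\mathrm{d}\ge0$. The degree of degeneracy of the standard $(\pi,\mathrm{d})$-extension $q_{\vec{\mathbb{A}}^{\mathrm{d}}_m[\pi]}$ of $q_{\mathbb{A}_{m-1}}$ equals $\mathrm{d}$.
   Context: For a quiver $Q$ with vertices $\{1,\dots,m\}$, arrows $\{1,\dots,n\}$ and source/target maps $s,t$, $I(Q)$ is the $m\times n$ matrix with $i$-th column $\mathbf{e}_{s(i)}-\mathbf{e}_{t(i)}$ and $q_Q(x)=\frac12\|I(Q)x\|^2$ for $x\in\mathbb{Z}^n$. For a unit form $q$, $G_q$ is the symmetric Gram matrix of $q(x+y)-q(x)-q(y)$, $\check G_q$ the upper triangular matrix with $q(x)=x^{\mathrm{tr}}\check G_qx$, $\mathrm{rad}(q)=\ker G_q$; the restriction of the bilinear form $(x,y)\mapsto x^{\mathrm{tr}}\check G_qy$ to $\mathrm{rad}(q)$ is skew-symmetric of rank $2\mathrm{d}_q$, and $\mathrm{d}_q$ is the degree of degeneracy of $q$. Standard quivers: for $\pi=(\pi_1\ge\dots\ge\pi_\ell>0)$ a partition of $m\ge2$, $\mathrm{d}\ge0$, $v_t=m-(\pi_1+\dots+\pi_t)$ ($t=0,\dots,\ell$), the quiver $\vec{\mathbb{A}}^{\mathrm{d}}_m[\pi]$ has vertices $1,\dots,m$ and $n=m+\ell+2(\mathrm{d}-1)$ arrows ordered $i_1<\dots<i_{m-1}<j_1<\dots<j_{\ell-1}<k_1<\dots<k_{2\mathrm{d}}$ (numbered $1,\dots,n$),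 with $s(i_t)=t,t(i_t)=t+1$; $s(j_t)=v_{t-1},t(j_t)=v_t$ ($1\le t\le\ell-1$); and with $\alpha=i_{m-1}$ if $\ell=1$, $\alpha=j_{\ell-1}$ if $\ell>1$, $k_t$ goes from $s(\alpha)$ to $t(\alpha)$ for $t$ even and from $t(\alpha)$ to $s(\alpha)$ for $t$ odd. -}

module Defs where

open import Data.Nat as ℕ using (ℕ; zero; suc; _≤_; _≥_; _<?_)
open import Data.Nat.DivMod using (_/_)
open import Data.Integer as ℤ using (ℤ; +_; 0ℤ; 1ℤ; -1ℤ)
open import Data.Fin as Fin using (Fin; toℕ; punchIn; _<_)
open import Data.List as List using (List; []; _∷_; _++_; length; take; upTo; lookup)
open import Data.Nat.ListAction renaming (sum to sumℕ)
open import Data.List.Relation.Unary.All using (All)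
open import Data.List.Relation.Unary.Linked using (Linked)
open import Data.Product using (_×_; _,_; proj₁; proj₂; Σ; ∃)
open import Relation.Binary.PropositionalEquality using (_≡_; _≢_)
open import Relation.Nullary.Decidable using (does)
open import Data.Bool using (if_then_else_)

IsPartition : ℕ → List ℕ → Set
IsPartition m π = All (λ p → 1 ≤ p) π × Linked _≥_ π × sumℕ π ≡ m

-- Quivers. Vertices are labelled 1,…,nV (as natural numbers), arrows
-- are indexed by Fin nA (arrow a ↔ paper's arrow toℕ a + 1).

record Quiver : Set where
  field
    nV  : ℕ
    nA  : ℕ
    src : Fin nA → ℕ
    tgt : Fin nA → ℕ
open Quiver public

quiverFromList : ℕ → List (ℕ × ℕ) → Quiver
quiverFromList m as = record
  { nV = m ; nA = length as
  ; src = λ a → proj₁ (lookup as a)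
  ; tgt = λ a → proj₂ (lookup as a) }

∑ : ∀ {n} → (Fin n → ℤ) → ℤ
∑ {zero}  f = 0ℤ
∑ {suc n} f = f Fin.zero ℤ.+ ∑ (λ i → f (Fin.suc i))

δ : ℕ → ℕ → ℤ
δ a b = if does (a ℕ.≟ b) then 1ℤ else 0ℤ

-- incidence matrix I(Q) (m × n): column a is e_{s(a)} - e_{t(a)};
-- row i (Fin m) corresponds to vertex toℕ i + 1
incidence : (Q : Quiver) → Fin (nV Q) → Fin (nA Q) → ℤ
incidence Q i a = δ (src Q a) (suc (toℕ i)) ℤ.- δ (tgt Q a) (suc (toℕ i))

qQ : (Q : Quiver) → (Fin (nA Q) → ℤ) → ℤ
qQ Q x = + ((ℤ.∣ ∑ (λ i → Ix i ℤ.* Ix i) ∣) / 2)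
  where
  Ix : Fin (nV Q) → ℤ
  Ix i = ∑ (λ a → incidence Q i a ℤ.* x a)

Vecℤ : ℕ → Set
Vecℤ n = Fin n → ℤ

e : ∀ {n} → Fin n → Vecℤ n
e i j = if does (i Fin.≟ j) then 1ℤ else 0ℤ

_⊕_ : ∀ {n} → Vecℤ n → Vecℤ n → Vecℤ n
(x ⊕ y) i = x i ℤ.+ y i

G : ∀ {n} → (Vecℤ n → ℤ) → Fin n → Fin n → ℤ
G q i j = q (e i ⊕ e j) ℤ.- q (e i) ℤ.- q (e j)

-- upper triangular Ǧ_q with q(x) = xᵀ Ǧ_q x
Ǧ : ∀ {n} → (Vecℤ n → ℤ) → Fin n → Fin n → ℤ
Ǧ q i j = if does (i Fin.<? j) then G q i j
           else (if does (i Fin.≟ j) then q (e i) else 0ℤ)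

rad : ∀ {n} → (Vecℤ n → ℤ) → Vecℤ n → Set
rad q x = ∀ i → ∑ (λ j → G q i j ℤ.* x j) ≡ 0ℤ

Ǧform : ∀ {n} → (Vecℤ n → ℤ) → Vecℤ n → Vecℤ n → ℤ
Ǧform q x y = ∑ (λ i → ∑ (λ j → x i ℤ.* Ǧ q i j ℤ.* y j))

det : ∀ r → (Fin r → Fin r → ℤ) → ℤ
det zero    M = 1ℤ
det (suc r) M = ∑ (λ j → sign j ℤ.* M Fin.zero j ℤ.* det r (λ i k → M (Fin.suc i) (punchIn j k)))
  where
  sign : Fin (suc r) → ℤ
  sign j = -1ℤ ℤ.^ toℕ j

-- The bilinear form b restricted to the subgroup W ⊆ ℤⁿ has rank r:
-- r is the largest size of a nonsingular matrix (b(xᵢ,yⱼ)) with xᵢ,yⱼ ∈ W.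
RankOn : ∀ {n} → (Vecℤ n → Vecℤ n → ℤ) → (Vecℤ n → Set) → ℕ → Set
RankOn {n} b W r =
  (Σ (Fin r → Vecℤ n) λ xs → Σ (Fin r → Vecℤ n) λ ys →
     (∀ i → W (xs i)) × (∀ i → W (ys i)) × det r (λ i j → b (xs i) (ys j)) ≢ 0ℤ)
  × ((xs ys : Fin (suc r) → Vecℤ n) → (∀ i → W (xs i)) → (∀ i → W (ys i)) →
       det (suc r) (λ i j → b (xs i) (ys j)) ≡ 0ℤ)

DegreeOfDegeneracy : ∀ {n} → (Vecℤ n → ℤ) → ℕ → Set
DegreeOfDegeneracy q D = RankOn (Ǧform q) (rad q) (2 ℕ.* D)

v : ℕ → List ℕ → ℕ → ℕ
v m π t = m ℕ.∸ sumℕ (take t π)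

iArrows : ℕ → List (ℕ × ℕ)
iArrows m = List.map (λ u → (suc u , suc (suc u))) (upTo (m ℕ.∸ 1))

jArrows : ℕ → List ℕ → List (ℕ × ℕ)
jArrows m π = List.map (λ u → (v m π u , v m π (suc u))) (upTo (length π ℕ.∸ 1))

αArrow : ℕ → List ℕ → ℕ × ℕ
αArrow m π with length π
... | suc zero = (m ℕ.∸ 1 , m)
... | ℓ        = (v m π (ℓ ℕ.∸ 2) , v m π (ℓ ℕ.∸ 1))

kArrows : ℕ × ℕ → ℕ → List (ℕ × ℕ)
kArrows (a , b) zero    = []
kArrows (a , b) (suc d) = (b , a) ∷ (a , b) ∷ kArrows (a , b) d

stdQuiver : (m : ℕ) → List ℕ → ℕ → Quiver
stdQuiver m π d = quiverFromList m (iArrows m ++ jArrows m π ++ kArrows (αArrow m π) d)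

-- Split the arrows of the standard quiver into the path of i-arrows, the descending chain of
-- j-arrows, and α together with its 2d parallel arrows k₁ … k_{2d}. Since G_q = I(Q)ᵀ I(Q) and
-- the path visits all vertices, x lies in rad q exactly when I(Q) x = 0. For such x and y the
-- form xᵀ Ǧ_q y can be evaluated by peeling off arrows against prefix-sum potentials: the path
-- and the chain contribute nothing, which leaves an explicit form in the coordinates of the
-- parallel class. That form is a sum of 2d products of linear forms, so every (2d+1)-minor
-- vanishes, while 2d explicit radical vectors give a minor equal to ±1.

module Submission where

open import Defs
open import Data.Nat as ℕ using (ℕ; zero; suc; _≤_; _<_; _≤?_; _∸_; z≤n; s≤s)
import Data.Nat.Properties as ℕP
open import Data.Nat.DivMod using (_/_; m*n/n≡m)
open import Data.Nat.ListAction renaming (sum to sumℕ)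
open import Data.Integer as ℤ using (ℤ; 0ℤ; 1ℤ; -1ℤ; _+_; _*_; _-_; -_)
import Data.Integer.Properties as ℤP
open import Data.Integer.Tactic.RingSolver using (solve-∀)
open import Data.Fin as Fin using (Fin; toℕ; punchIn)
open import Data.Fin.Properties using (pigeonhole; toℕ-injective; toℕ<n; toℕ-fromℕ<)
open import Data.Vec.Functional using (updateAt)
open import Data.Vec.Functional.Properties using (updateAt-updates; updateAt-minimal; updateAt-commutes)
open import Data.List using (List; []; _∷_; _++_; length; lookup; take; applyUpTo)
import Data.List.Properties as ListP
open import Data.List.Relation.Unary.All as All using (All; []; _∷_)
open import Data.List.Relation.Unary.All.Properties using (++⁺; ++⁻ˡ; ++⁻ʳ)
import Data.List.Relation.Unary.Any as Any
open import Data.List.Relation.Unary.Any.Properties using (lookup-index)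
open import Data.List.Membership.Propositional.Properties using (∈-lookup)
open import Data.Product using (_×_; _,_; proj₁; proj₂; Σ)
open import Data.Sum using (_⊎_; inj₁; inj₂)
open import Data.Bool using (if_then_else_)
open import Data.Empty using (⊥-elim)
open import Relation.Binary.PropositionalEquality
open import Relation.Nullary using (¬_; yes; no)
open import Relation.Nullary.Decidable using (dec-true; dec-false; does)
open import Function using (_∘_; const; id)


∑-cong : ∀ {n} {f g : Fin n → ℤ} → (∀ i → f i ≡ g i) → ∑ f ≡ ∑ g
∑-cong {zero}  h = refl
∑-cong {suc n} h = cong₂ _+_ (h Fin.zero) (∑-cong (h ∘ Fin.suc))

∑-zero : ∀ {n} {f : Fin n → ℤ} → (∀ i → f i ≡ 0ℤ) → ∑ f ≡ 0ℤ
∑-zero {zero}  h = refl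
∑-zero {suc n} h = cong₂ _+_ (h Fin.zero) (∑-zero (h ∘ Fin.suc))

∑-+ : ∀ {n} (f g : Fin n → ℤ) → ∑ (λ i → f i + g i) ≡ ∑ f + ∑ g
∑-+ {zero}  f g = refl
∑-+ {suc n} f g =
  trans (cong (f Fin.zero + g Fin.zero +_) (∑-+ (f ∘ Fin.suc) (g ∘ Fin.suc)))
        (interchange (f Fin.zero) (g Fin.zero) _ _)
  where
  interchange : ∀ a b c d → a + b + (c + d) ≡ a + c + (b + d)
  interchange = solve-∀

∑-*ˡ : ∀ {n} (c : ℤ) (f : Fin n → ℤ) → ∑ (λ i → c * f i) ≡ c * ∑ f
∑-*ˡ {zero}  c f = sym (ℤP.*-zeroʳ c)
∑-*ˡ {suc n} c f =
  trans (cong (c * f Fin.zero +_) (∑-*ˡ c (f ∘ Fin.suc))) (sym (ℤP.*-distribˡ-+ c _ _))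

∑-neg : ∀ {n} (f : Fin n → ℤ) → ∑ (λ i → - f i) ≡ - ∑ f
∑-neg {zero}  f = refl
∑-neg {suc n} f =
  trans (cong (- f Fin.zero +_) (∑-neg (f ∘ Fin.suc))) (sym (ℤP.neg-distrib-+ (f Fin.zero) _))

∑-minus : ∀ {n} (f g : Fin n → ℤ) → ∑ (λ i → f i - g i) ≡ ∑ f - ∑ g
∑-minus f g = trans (∑-+ f (λ i → - g i)) (cong (∑ f +_) (∑-neg g))

∑-swap : ∀ {n m} (f : Fin n → Fin m → ℤ) → ∑ (λ i → ∑ (f i)) ≡ ∑ (λ j → ∑ (λ i → f i j))
∑-swap {zero} {m} f = sym (∑-zero {m} (λ _ → refl))
∑-swap {suc n} f =
  trans (cong (∑ (f Fin.zero) +_) (∑-swap (f ∘ Fin.suc)))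
        (sym (∑-+ (f Fin.zero) (λ j → ∑ (λ i → f (Fin.suc i) j))))

e-suc : ∀ {n} (a b : Fin n) → e (Fin.suc a) (Fin.suc b) ≡ e a b
e-suc a b with a Fin.≟ b
... | yes _ = refl
... | no  _ = refl

∑-e* : ∀ {n} (a : Fin n) (g : Fin n → ℤ) → ∑ (λ b → e a b * g b) ≡ g a
∑-e* Fin.zero g =
  trans (cong₂ _+_ (ℤP.*-identityˡ (g Fin.zero)) (∑-zero (λ i → ℤP.*-zeroˡ (g (Fin.suc i)))))
        (ℤP.+-identityʳ _)
∑-e* (Fin.suc a) g =
  trans (cong₂ _+_ (ℤP.*-zeroˡ (g Fin.zero))
                   (trans (∑-cong (λ b → cong (_* g (Fin.suc b)) (e-suc a b))) (∑-e* a (g ∘ Fin.suc))))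
        (ℤP.+-identityˡ _)

∑-punchIn : ∀ {n} (a : Fin (suc n)) (f : Fin (suc n) → ℤ) → ∑ (f ∘ punchIn a) ≡ ∑ f - f a
∑-punchIn Fin.zero f = cancel (f Fin.zero) _
  where
  cancel : ∀ x y → y ≡ x + y - x
  cancel = solve-∀
∑-punchIn {suc n} (Fin.suc a) f =
  trans (cong (f Fin.zero +_) (∑-punchIn a (f ∘ Fin.suc))) (reassoc (f Fin.zero) _ _)
  where
  reassoc : ∀ x y z → x + (y - z) ≡ x + y - z
  reassoc = solve-∀

-- Determinants

Mat : ℕ → Set
Mat r = Fin r → Fin r → ℤ

sign : ∀ {n} → Fin n → ℤ
sign j = -1ℤ ℤ.^ toℕ j

minor : ∀ {r} → Mat (suc r) → Fin (suc r) → Mat r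
minor M j i k = M (Fin.suc i) (punchIn j k)

det-cong : ∀ r {M N : Mat r} → (∀ i j → M i j ≡ N i j) → det r M ≡ det r N
det-cong zero    h = refl
det-cong (suc r) h =
  ∑-cong (λ j → cong₂ _*_ (cong (sign j *_) (h Fin.zero j)) (det-cong r (λ i k → h (Fin.suc i) (punchIn j k))))

replaceRow : ∀ {r n} → (Fin r → Fin n → ℤ) → Fin r → (Fin n → ℤ) → Fin r → Fin n → ℤ
replaceRow M p u = updateAt M p (const u)

replaceRow-at : ∀ {r n} (M : Fin r → Fin n → ℤ) p u j → replaceRow M p u p j ≡ u j
replaceRow-at M p u j = cong (λ row → row j) (updateAt-updates p M)

replaceRow-other : ∀ {r n} (M : Fin r → Fin n → ℤ) p u i j → i ≢ p → replaceRow M p u i j ≡ M i j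
replaceRow-other M p u i j i≢p = cong (λ row → row j) (updateAt-minimal i p M i≢p)

replaceRow-self : ∀ {r n} (M : Fin r → Fin n → ℤ) p {u} → (∀ j → M p j ≡ u j) →
  ∀ i j → replaceRow M p u i j ≡ M i j
replaceRow-self M p {u} M≡u i j with i Fin.≟ p
... | yes refl = trans (replaceRow-at M i u j) (sym (M≡u j))
... | no  i≢p  = replaceRow-other M p u i j i≢p

replaceRow-comm : ∀ {r n} (M : Fin r → Fin n → ℤ) p q u w → p ≢ q →
  ∀ i j → replaceRow (replaceRow M q w) p u i j ≡ replaceRow (replaceRow M p u) q w i j
replaceRow-comm M p q u w p≢q i j = cong (λ row → row j) (updateAt-commutes p q p≢q M i)

minor-replaceRow : ∀ {r} (M : Mat (suc (suc r))) p u j i k →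
  minor (replaceRow M (Fin.suc p) u) j i k ≡ replaceRow (minor M j) p (u ∘ punchIn j) i k
minor-replaceRow M p u j i k with i Fin.≟ p
... | yes refl = trans (replaceRow-at (M ∘ Fin.suc) i u (punchIn j k))
                       (sym (replaceRow-at (minor M j) i (u ∘ punchIn j) k))
... | no  i≢p  = trans (replaceRow-other (M ∘ Fin.suc) p u i (punchIn j k) i≢p)
                       (sym (replaceRow-other (minor M j) p (u ∘ punchIn j) i k i≢p))

det-replaceRow-+ : ∀ r (M : Mat r) p (u w : Fin r → ℤ) →
  det r (replaceRow M p (λ j → u j + w j)) ≡ det r (replaceRow M p u) + det r (replaceRow M p w)
det-replaceRow-+ (suc r) M Fin.zero u w =
  trans (∑-cong (λ j → distrib (sign j) (u j) (w j) (det r (minor M j))))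
        (∑-+ (λ j → sign j * u j * det r (minor M j)) (λ j → sign j * w j * det r (minor M j)))
  where
  distrib : ∀ s a b d → s * (a + b) * d ≡ s * a * d + s * b * d
  distrib = solve-∀
det-replaceRow-+ (suc r@(suc _)) M (Fin.suc p) u w =
  trans (∑-cong expand) (∑-+ (term u) (term w))
  where
  term : (Fin (suc r) → ℤ) → Fin (suc r) → ℤ
  term z j = sign j * M Fin.zero j * det r (minor (replaceRow M (Fin.suc p) z) j)
  minorDet : ∀ z j → det r (minor (replaceRow M (Fin.suc p) z) j)
                   ≡ det r (replaceRow (minor M j) p (z ∘ punchIn j))
  minorDet z j = det-cong r (minor-replaceRow M p z j)
  expand : ∀ j → term (λ k → u k + w k) j ≡ term u j + term w j
  expand j = begin
    sign j * M Fin.zero j * det r (minor (replaceRow M (Fin.suc p) (λ k → u k + w k)) j)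
      ≡⟨ cong (sign j * M Fin.zero j *_)
           (trans (minorDet (λ k → u k + w k) j)
                  (trans (det-replaceRow-+ r (minor M j) p (u ∘ punchIn j) (w ∘ punchIn j))
                         (sym (cong₂ _+_ (minorDet u j) (minorDet w j))))) ⟩
    sign j * M Fin.zero j * (det r (minor (replaceRow M (Fin.suc p) u) j)
                             + det r (minor (replaceRow M (Fin.suc p) w) j))
      ≡⟨ ℤP.*-distribˡ-+ (sign j * M Fin.zero j) _ _ ⟩
    term u j + term w j ∎
    where open ≡-Reasoning

det-replaceRow-* : ∀ r (M : Mat r) p (c : ℤ) (u : Fin r → ℤ) →
  det r (replaceRow M p (λ j → c * u j)) ≡ c * det r (replaceRow M p u)
det-replaceRow-* (suc r) M Fin.zero c u =
  trans (∑-cong (λ j → commute (sign j) c (u j) (det r (minor M j))))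
        (∑-*ˡ c (λ j → sign j * u j * det r (minor M j)))
  where
  commute : ∀ s c a d → s * (c * a) * d ≡ c * (s * a * d)
  commute = solve-∀
det-replaceRow-* (suc r@(suc _)) M (Fin.suc p) c u =
  trans (∑-cong pull) (∑-*ˡ c (term u))
  where
  term : (Fin (suc r) → ℤ) → Fin (suc r) → ℤ
  term z j = sign j * M Fin.zero j * det r (minor (replaceRow M (Fin.suc p) z) j)
  commute : ∀ s a c d → s * a * (c * d) ≡ c * (s * a * d)
  commute = solve-∀
  pull : ∀ j → term (λ k → c * u k) j ≡ c * term u j
  pull j =
    trans (cong (sign j * M Fin.zero j *_)
            (trans (det-cong r (minor-replaceRow M p (λ k → c * u k) j))
            (trans (det-replaceRow-* r (minor M j) p c (u ∘ punchIn j))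
                   (cong (c *_) (sym (det-cong r (minor-replaceRow M p u j)))))))
          (commute (sign j) (M Fin.zero j) c _)

det-replaceRow-∑ : ∀ r (M : Mat r) p {n} (a : Fin n → ℤ) (C : Fin n → Fin r → ℤ) →
  det r (replaceRow M p (λ j → ∑ (λ k → a k * C k j))) ≡ ∑ (λ k → a k * det r (replaceRow M p (C k)))
det-replaceRow-∑ r M p {zero} a C =
  trans (det-replaceRow-* r M p 0ℤ (λ _ → 0ℤ)) (ℤP.*-zeroˡ (det r (replaceRow M p (λ _ → 0ℤ))))
det-replaceRow-∑ r M p {suc n} a C =
  trans (det-replaceRow-+ r M p (λ j → a Fin.zero * C Fin.zero j) (λ j → ∑ (λ k → a (Fin.suc k) * C (Fin.suc k) j)))
        (cong₂ _+_ (det-replaceRow-* r M p (a Fin.zero) (C Fin.zero))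
                   (det-replaceRow-∑ r M p (a ∘ Fin.suc) (C ∘ Fin.suc)))

-- A total punchOut: punchOut′ a b is the position of b once a is removed (junk when a ≡ b).
punchOut′ : ∀ {n} → Fin (suc (suc n)) → Fin (suc (suc n)) → Fin (suc n)
punchOut′ Fin.zero        Fin.zero        = Fin.zero
punchOut′ Fin.zero        (Fin.suc j)     = j
punchOut′ (Fin.suc i)     Fin.zero        = Fin.zero
punchOut′ {zero}  (Fin.suc i) (Fin.suc j) = Fin.zero
punchOut′ {suc n} (Fin.suc i) (Fin.suc j) = Fin.suc (punchOut′ i j)

punchOut′-punchIn : ∀ {n} (a : Fin (suc (suc n))) (k : Fin (suc n)) → punchOut′ a (punchIn a k) ≡ k
punchOut′-punchIn Fin.zero            k           = refl
punchOut′-punchIn (Fin.suc a)         Fin.zero    = refl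
punchOut′-punchIn {suc n} (Fin.suc a) (Fin.suc k) = cong Fin.suc (punchOut′-punchIn a k)

punchIn-punchOut′-comm : ∀ {n} (a b : Fin (suc (suc n))) → a ≢ b → ∀ (l : Fin n) →
  punchIn a (punchIn (punchOut′ a b) l) ≡ punchIn b (punchIn (punchOut′ b a) l)
punchIn-punchOut′-comm Fin.zero    Fin.zero    a≢b l = ⊥-elim (a≢b refl)
punchIn-punchOut′-comm Fin.zero    (Fin.suc b) a≢b l = refl
punchIn-punchOut′-comm (Fin.suc a) Fin.zero    a≢b l = refl
punchIn-punchOut′-comm {zero}  (Fin.suc Fin.zero) (Fin.suc Fin.zero) a≢b l = ⊥-elim (a≢b refl)
punchIn-punchOut′-comm {suc n} (Fin.suc a) (Fin.suc b) a≢b Fin.zero    = refl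
punchIn-punchOut′-comm {suc n} (Fin.suc a) (Fin.suc b) a≢b (Fin.suc l) =
  cong Fin.suc (punchIn-punchOut′-comm a b (a≢b ∘ cong Fin.suc) l)

sign-punchOut′-anti : ∀ {n} (a b : Fin (suc (suc n))) → a ≢ b →
  sign a * sign (punchOut′ a b) ≡ - (sign b * sign (punchOut′ b a))
sign-punchOut′-anti Fin.zero    Fin.zero    a≢b = ⊥-elim (a≢b refl)
sign-punchOut′-anti Fin.zero    (Fin.suc b) a≢b = signs (sign b)
  where
  signs : ∀ x → 1ℤ * x ≡ - (-1ℤ * x * 1ℤ)
  signs = solve-∀
sign-punchOut′-anti (Fin.suc a) Fin.zero    a≢b = signs (sign a)
  where
  signs : ∀ x → -1ℤ * x * 1ℤ ≡ - (1ℤ * x)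
  signs = solve-∀
sign-punchOut′-anti {zero}  (Fin.suc Fin.zero) (Fin.suc Fin.zero) a≢b = ⊥-elim (a≢b refl)
sign-punchOut′-anti {suc n} (Fin.suc a) (Fin.suc b) a≢b =
  trans (signs (sign a) (sign (punchOut′ a b)))
        (trans (sign-punchOut′-anti a b (a≢b ∘ cong Fin.suc))
               (cong -_ (sym (signs (sign b) (sign (punchOut′ b a))))))
  where
  signs : ∀ x y → -1ℤ * x * (-1ℤ * y) ≡ x * y
  signs = solve-∀

+-double-injective : ∀ x y → x + x ≡ y + y → x ≡ y
+-double-injective x y eq =
  ℤP.*-cancelʳ-≡ x y (ℤ.+ 2) (trans (double x) (trans eq (sym (double y))))
  where
  double : ∀ x → x * ℤ.+ 2 ≡ x + x
  double = solve-∀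

-- Expanding along the first two rows writes det M as a sum over ordered pairs a ≢ b
-- of columns; when the two rows agree, the terms for (a , b) and (b , a) cancel.
det-equalRows₀₁ : ∀ r (M : Mat (suc (suc r))) → (∀ j → M Fin.zero j ≡ M (Fin.suc Fin.zero) j) →
  det (suc (suc r)) M ≡ 0ℤ
det-equalRows₀₁ r M row₀≡row₁ =
  trans det≡X-Y (trans (cong (_- Y) (+-double-injective X Y X+X≡Y+Y)) (ℤP.+-inverseʳ Y))
  where
  u : Fin (suc (suc r)) → ℤ
  u = M Fin.zero
  φ : Fin (suc (suc r)) → Fin (suc (suc r)) → ℤ
  φ a b = sign a * sign (punchOut′ a b) * (u a * u b) * det r (minor (minor M a) (punchOut′ a b))
  X Y : ℤ
  X = ∑ (λ a → ∑ (φ a))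
  Y = ∑ (λ a → φ a a)
  rearrange : ∀ s t x y d → s * x * (t * y * d) ≡ s * t * (x * y) * d
  rearrange = solve-∀
  term : ∀ a k → sign a * u a * (sign k * M (Fin.suc Fin.zero) (punchIn a k) * det r (minor (minor M a) k))
               ≡ φ a (punchIn a k)
  term a k rewrite punchOut′-punchIn a k | sym (row₀≡row₁ (punchIn a k)) =
    rearrange (sign a) (sign k) (u a) (u (punchIn a k)) _
  row : ∀ a → sign a * u a * det (suc r) (minor M a) ≡ ∑ (φ a) - φ a a
  row a = trans (sym (∑-*ˡ (sign a * u a) expansion)) (trans (∑-cong (term a)) (∑-punchIn a (φ a)))
    where
    expansion : Fin (suc r) → ℤ
    expansion k = sign k * M (Fin.suc Fin.zero) (punchIn a k) * det r (minor (minor M a) k)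
  det≡X-Y : det (suc (suc r)) M ≡ X - Y
  det≡X-Y = trans (∑-cong row) (∑-minus (λ a → ∑ (φ a)) (λ a → φ a a))
  antisym : ∀ a b → a ≢ b → φ a b + φ b a ≡ 0ℤ
  antisym a b a≢b
    rewrite sign-punchOut′-anti a b a≢b
          | det-cong r (λ i l → cong (M (Fin.suc (Fin.suc i))) (punchIn-punchOut′-comm a b a≢b l))
    = cancel (sign b * sign (punchOut′ b a)) (u a) (u b) _
    where
    cancel : ∀ s x y d → - s * (x * y) * d + s * (y * x) * d ≡ 0ℤ
    cancel = solve-∀
  diagonal : ∀ a b → φ a b + φ b a ≡ e a b * (φ a b + φ b a)
  diagonal a b with a Fin.≟ b
  ... | yes _   = sym (ℤP.*-identityˡ _)
  ... | no  a≢b = trans (antisym a b a≢b) (sym (ℤP.*-zeroˡ (φ a b + φ b a)))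
  X+X≡Y+Y : X + X ≡ Y + Y
  X+X≡Y+Y = begin
    X + X                                       ≡⟨ cong (X +_) (∑-swap φ) ⟩
    X + ∑ (λ b → ∑ (λ a → φ a b))               ≡⟨ sym (∑-+ (λ a → ∑ (φ a)) (λ a → ∑ (λ b → φ b a))) ⟩
    ∑ (λ a → ∑ (φ a) + ∑ (λ b → φ b a))         ≡⟨ ∑-cong (λ a → sym (∑-+ (φ a) (λ b → φ b a))) ⟩
    ∑ (λ a → ∑ (λ b → φ a b + φ b a))           ≡⟨ ∑-cong (λ a → trans (∑-cong (diagonal a))
                                                                        (∑-e* a (λ b → φ a b + φ b a))) ⟩
    ∑ (λ a → φ a a + φ a a)                     ≡⟨ ∑-+ (λ a → φ a a) (λ a → φ a a) ⟩
    Y + Y                                       ∎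
    where open ≡-Reasoning

-- Polarisation: with f x y the determinant after putting x in row 1 and y in row q,
-- f is bilinear, vanishes on the diagonal and for x = row 0, hence f (row 1) (row 0) = 0.
det-equalRows₀ : ∀ r (M : Mat (suc (suc r))) (q : Fin r) →
  (∀ j → M Fin.zero j ≡ M (Fin.suc (Fin.suc q)) j) →
  (∀ v → det (suc (suc r)) (replaceRow (replaceRow M (Fin.suc Fin.zero) v) (Fin.suc (Fin.suc q)) v) ≡ 0ℤ) →
  det (suc (suc r)) M ≡ 0ℤ
det-equalRows₀ r M q rows≡ diagonal =
  trans (sym (det-cong N M≡w,u)) (trans (sym polarise) (diagonal (λ j → w j + u j)))
  where
  N = suc (suc r)
  one q′ : Fin N
  one = Fin.suc Fin.zero
  q′  = Fin.suc (Fin.suc q)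
  one≢q′ : one ≢ q′
  one≢q′ ()
  u w : Fin N → ℤ
  u = M Fin.zero
  w = M one
  f : (Fin N → ℤ) → (Fin N → ℤ) → ℤ
  f x y = det N (replaceRow (replaceRow M one x) q′ y)
  comm : ∀ x y i j → replaceRow (replaceRow M one x) q′ y i j ≡ replaceRow (replaceRow M q′ y) one x i j
  comm x y = replaceRow-comm M q′ one y x (one≢q′ ∘ sym)
  additiveˡ : ∀ x x′ y → f (λ j → x j + x′ j) y ≡ f x y + f x′ y
  additiveˡ x x′ y =
    trans (det-cong N (comm (λ j → x j + x′ j) y))
          (trans (det-replaceRow-+ N (replaceRow M q′ y) one x x′)
                 (sym (cong₂ _+_ (det-cong N (comm x y)) (det-cong N (comm x′ y)))))
  additiveʳ : ∀ x y y′ → f x (λ j → y j + y′ j) ≡ f x y + f x y′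
  additiveʳ x y y′ = det-replaceRow-+ N (replaceRow M one x) q′ y y′
  vanishesˡ : ∀ y → f u y ≡ 0ℤ
  vanishesˡ y = det-equalRows₀₁ r (replaceRow (replaceRow M one u) q′ y) λ j →
    trans (replaceRow-other (replaceRow M one u) q′ y Fin.zero j (λ ()))
          (sym (trans (replaceRow-other (replaceRow M one u) q′ y one j one≢q′)
                      (replaceRow-at M one u j)))
  M≡w,u : ∀ i j → replaceRow (replaceRow M one w) q′ u i j ≡ M i j
  M≡w,u i j with i Fin.≟ q′
  ... | yes refl = trans (replaceRow-at (replaceRow M one w) q′ u j) (rows≡ j)
  ... | no  i≢q′ = trans (replaceRow-other (replaceRow M one w) q′ u i j i≢q′)
                         (replaceRow-self M one (λ _ → refl) i j)
  rearrange : ∀ x → 0ℤ + x + 0ℤ ≡ x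
  rearrange = solve-∀
  polarise : f (λ j → w j + u j) (λ j → w j + u j) ≡ f w u
  polarise =
    trans (additiveˡ w u (λ j → w j + u j))
          (trans (cong₂ _+_ (additiveʳ w w u) (vanishesˡ (λ j → w j + u j)))
                 (trans (cong (λ z → z + f w u + 0ℤ) (diagonal w)) (rearrange (f w u))))

det-equalRows : ∀ r (M : Mat r) {p q} → p Fin.< q → (∀ j → M p j ≡ M q j) → det r M ≡ 0ℤ
det-equalRows-suc : ∀ r (M : Mat (suc r)) {p q : Fin r} → p Fin.< q →
  (∀ j → M (Fin.suc p) j ≡ M (Fin.suc q) j) → det (suc r) M ≡ 0ℤ

det-equalRows-suc r M p<q rows≡ =
  ∑-zero λ j → trans (cong (sign j * M Fin.zero j *_)
                           (det-equalRows r (minor M j) p<q (rows≡ ∘ punchIn j)))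
                     (ℤP.*-zeroʳ (sign j * M Fin.zero j))

det-equalRows (suc (suc r)) M {Fin.zero} {Fin.suc Fin.zero} _ rows≡ = det-equalRows₀₁ r M rows≡
det-equalRows (suc (suc r)) M {Fin.zero} {Fin.suc (Fin.suc q)} _ rows≡ =
  det-equalRows₀ r M q rows≡ λ v → det-equalRows-suc (suc r) (B v) {Fin.zero} {Fin.suc q} (s≤s z≤n) (B-rows≡ v)
  where
  one q′ : Fin (suc (suc r))
  one = Fin.suc Fin.zero
  q′  = Fin.suc (Fin.suc q)
  B : (Fin (suc (suc r)) → ℤ) → Mat (suc (suc r))
  B v = replaceRow (replaceRow M one v) q′ v
  B-rows≡ : ∀ v j → B v one j ≡ B v q′ j
  B-rows≡ v j = trans (replaceRow-other (replaceRow M one v) q′ v one j (λ ()))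
                      (trans (replaceRow-at M one v j) (sym (replaceRow-at (replaceRow M one v) q′ v j)))
det-equalRows (suc r) M {Fin.suc p} {Fin.suc q} p<q rows≡ = det-equalRows-suc r M (ℕP.≤-pred p<q) rows≡

-- Expanding the combination rows one at a time by multilinearity leaves matrices whose rows
-- are all rows of C; as n < N, two of them coincide.
module _ {N n : ℕ} (C : Fin n → Fin N → ℤ) where

  IsRowOf IsCombinationOf : (Fin N → ℤ) → Set
  IsRowOf u = Σ (Fin n) λ k → ∀ j → u j ≡ C k j
  IsCombinationOf u = Σ (Fin n → ℤ) λ a → ∀ j → u j ≡ ∑ (λ k → a k * C k j)

  RowsBelow : ℕ → Mat N → Set
  RowsBelow t R = ∀ i → IsRowOf (R i) ⊎ (toℕ i ℕ.< t × IsCombinationOf (R i))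

  private
    det-rowsOf : n ℕ.< N → ∀ R → RowsBelow 0 R → det N R ≡ 0ℤ
    det-rowsOf n<N R rows = det-equalRows N R i<j λ c →
      trans (proj₂ (row i) c) (trans (cong (λ k → C k c) fi≡fj) (sym (proj₂ (row j) c)))
      where
      row : ∀ i → IsRowOf (R i)
      row i with rows i
      ... | inj₁ r       = r
      ... | inj₂ (() , _)
      collision = pigeonhole n<N (proj₁ ∘ row)
      i j : Fin N
      i = proj₁ collision
      j = proj₁ (proj₂ collision)
      i<j = proj₁ (proj₂ (proj₂ collision))
      fi≡fj = proj₂ (proj₂ (proj₂ collision))

    det-rowsBelow-suc : ∀ t (t<N : t ℕ.< N) → (∀ R → RowsBelow t R → det N R ≡ 0ℤ) →
      ∀ R → RowsBelow (suc t) R → det N R ≡ 0ℤ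
    det-rowsBelow-suc t t<N ih R rows = byRow (rows p)
      where
      p : Fin N
      p = Fin.fromℕ< t<N
      replaced : ∀ k → RowsBelow t (replaceRow R p (C k))
      replaced k i with i Fin.≟ p | rows i
      ... | yes refl | _ = inj₁ (k , replaceRow-at R i (C k))
      ... | no i≢p | inj₁ (k′ , R≡C) = inj₁ (k′ , λ j → trans (replaceRow-other R p (C k) i j i≢p) (R≡C j))
      ... | no i≢p | inj₂ (i<1+t , a , R≡∑) =
        inj₂ (i<t , a , λ j → trans (replaceRow-other R p (C k) i j i≢p) (R≡∑ j))
        where
        i<t : toℕ i ℕ.< t
        i<t with ℕP.m≤n⇒m<n∨m≡n (ℕP.≤-pred i<1+t)
        ... | inj₁ i<t = i<t
        ... | inj₂ i≡t = ⊥-elim (i≢p (toℕ-injective (trans i≡t (sym (toℕ-fromℕ< t<N)))))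
      byRow : IsRowOf (R p) ⊎ (toℕ p ℕ.< suc t × IsCombinationOf (R p)) → det N R ≡ 0ℤ
      byRow (inj₁ (k , R≡C)) = trans (sym (det-cong N (replaceRow-self R p R≡C))) (ih _ (replaced k))
      byRow (inj₂ (_ , a , R≡∑)) =
        trans (sym (det-cong N (replaceRow-self R p R≡∑)))
              (trans (det-replaceRow-∑ N R p a C)
                     (∑-zero λ k → trans (cong (a k *_) (ih _ (replaced k))) (ℤP.*-zeroʳ (a k))))

  det-rowsBelow : n ℕ.< N → ∀ t → t ℕ.≤ N → ∀ R → RowsBelow t R → det N R ≡ 0ℤ
  det-rowsBelow n<N zero    _   = det-rowsOf n<N
  det-rowsBelow n<N (suc t) t<N = det-rowsBelow-suc t t<N (det-rowsBelow n<N t (ℕP.<⇒≤ t<N))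

det-lowRank : ∀ N n → n ℕ.< N → (A : Fin N → Fin n → ℤ) (C : Fin n → Fin N → ℤ) (M : Mat N) →
  (∀ i j → M i j ≡ ∑ (λ k → A i k * C k j)) → det N M ≡ 0ℤ
det-lowRank N n n<N A C M M≡AC =
  det-rowsBelow C n<N N ℕP.≤-refl M (λ i → inj₂ (toℕ<n i , A i , M≡AC i))

det-pivot : ∀ r (M : Mat (suc r)) → (∀ j → M Fin.zero (Fin.suc j) ≡ 0ℤ) →
  det (suc r) M ≡ M Fin.zero Fin.zero * det r (minor M Fin.zero)
det-pivot r M row₀ =
  trans (cong₂ _+_ (ℤP.*-assoc 1ℤ (M Fin.zero Fin.zero) _) (∑-zero offPivot))
        (trans (ℤP.+-identityʳ _) (ℤP.*-identityˡ _))
  where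
  offPivot : ∀ j → sign (Fin.suc j) * M Fin.zero (Fin.suc j) * det r (minor M (Fin.suc j)) ≡ 0ℤ
  offPivot j rewrite row₀ j | ℤP.*-zeroʳ (sign (Fin.suc j)) = ℤP.*-zeroˡ (det r (minor M (Fin.suc j)))

det-twoPivots : ∀ r (M : Mat (suc (suc r))) →
  (∀ j → M Fin.zero (Fin.suc j) ≡ 0ℤ) → (∀ j → M (Fin.suc Fin.zero) (Fin.suc (Fin.suc j)) ≡ 0ℤ) →
  det (suc (suc r)) M
    ≡ M Fin.zero Fin.zero * M (Fin.suc Fin.zero) (Fin.suc Fin.zero)
      * det r (λ i j → M (Fin.suc (Fin.suc i)) (Fin.suc (Fin.suc j)))
det-twoPivots r M row₀ row₁ =
  trans (det-pivot (suc r) M row₀)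
        (trans (cong (M Fin.zero Fin.zero *_) (det-pivot r (minor M Fin.zero) row₁))
               (sym (ℤP.*-assoc (M Fin.zero Fin.zero) _ _)))

-- Flows and the upper form of a list of arrows

-- An arrow-vector x is stored as a sequence, x i being the coordinate of the i-th arrow of the list.
Arrow : Set
Arrow = ℕ × ℕ

Seq : Set
Seq = ℕ → ℤ

shift : ℕ → Seq → Seq
shift k x i = x (k ℕ.+ i)

prependZeros : ℕ → Seq → Seq
prependZeros zero    x i       = x i
prependZeros (suc k) x zero    = 0ℤ
prependZeros (suc k) x (suc i) = prependZeros k x i

shift-prependZeros : ∀ k x → shift k (prependZeros k x) ≗ x
shift-prependZeros zero    x i = refl
shift-prependZeros (suc k) x i = shift-prependZeros k x i

δ-refl : ∀ a → δ a a ≡ 1ℤ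
δ-refl a = cong (λ b → if b then 1ℤ else 0ℤ) (dec-true (a ℕ.≟ a) refl)

δ-≢ : ∀ a b → a ≢ b → δ a b ≡ 0ℤ
δ-≢ a b a≢b = cong (λ b → if b then 1ℤ else 0ℤ) (dec-false (a ℕ.≟ b) a≢b)

heaviside : ℕ → ℕ → ℤ
heaviside s v = if does (s ≤? v) then 1ℤ else 0ℤ

heaviside-≤ : ∀ s v → s ≤ v → heaviside s v ≡ 1ℤ
heaviside-≤ s v s≤v = cong (λ b → if b then 1ℤ else 0ℤ) (dec-true (s ≤? v) s≤v)

heaviside-≰ : ∀ s v → ¬ s ≤ v → heaviside s v ≡ 0ℤ
heaviside-≰ s v s≰v = cong (λ b → if b then 1ℤ else 0ℤ) (dec-false (s ≤? v) s≰v)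

heaviside≡δ : ∀ s u → u ≤ s → heaviside s u ≡ δ s u
heaviside≡δ s u u≤s with s ℕ.≟ u
... | yes refl = trans (heaviside-≤ s s ℕP.≤-refl) (sym (δ-refl s))
... | no  s≢u  = trans (heaviside-≰ s u (λ s≤u → s≢u (ℕP.≤-antisym s≤u u≤s))) (sym (δ-≢ s u s≢u))

-- column a is the column of I(Q) belonging to a, so that flow A x = I(Q) x and
-- pairing A x h = ⟨x , I(Q)ᵀ h⟩ for a potential h on the vertices.
column : Arrow → ℕ → ℤ
column (s , t) v = δ s v - δ t v

∇ : Arrow → (ℕ → ℤ) → ℤ
∇ (s , t) h = h s - h t

flow : List Arrow → Seq → ℕ → ℤ
flow []      x v = 0ℤ
flow (a ∷ A) x v = x 0 * column a v + flow A (x ∘ suc) v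

pairing : List Arrow → Seq → (ℕ → ℤ) → ℤ
pairing []      x h = 0ℤ
pairing (a ∷ A) x h = x 0 * ∇ a h + pairing A (x ∘ suc) h

-- x ᵀ Ǧ y for a list of loopless arrows: Ǧ has 1 on the diagonal and ∇ a (column b) above it.
upperForm : List Arrow → Seq → Seq → ℤ
upperForm []      x y = 0ℤ
upperForm (a ∷ A) x y = x 0 * y 0 + x 0 * ∇ a (flow A (y ∘ suc)) + upperForm A (x ∘ suc) (y ∘ suc)

prefixSum : (ℕ → ℤ) → ℕ → ℤ
prefixSum g zero    = g zero
prefixSum g (suc w) = prefixSum g w + g (suc w)

-- Agrees with upperForm on vectors of zero flow, and unlike upperForm it can be peeled off
-- arrow by arrow (correctedForm-∷).
correctedForm : List Arrow → Seq → Seq → ℤ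
correctedForm A x y =
  pairing A x (prefixSum (flow A y)) - pairing A x (flow A y) + upperForm A x y

∇-cong : ∀ a {h h′} → h ≗ h′ → ∇ a h ≡ ∇ a h′
∇-cong (s , t) h≗h′ = cong₂ _-_ (h≗h′ s) (h≗h′ t)

∇-+ : ∀ a h h′ → ∇ a (λ v → h v + h′ v) ≡ ∇ a h + ∇ a h′
∇-+ (s , t) h h′ = rearrange (h s) (h′ s) (h t) (h′ t)
  where
  rearrange : ∀ a b c d → a + b - (c + d) ≡ a - c + (b - d)
  rearrange = solve-∀

∇-* : ∀ a k h → ∇ a (λ v → k * h v) ≡ k * ∇ a h
∇-* (s , t) k h = factor k (h s) (h t)
  where
  factor : ∀ k a b → k * a - k * b ≡ k * (a - b)
  factor = solve-∀

∇-neg : ∀ a h → ∇ a (λ v → - h v) ≡ - ∇ a h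
∇-neg (s , t) h = negate (h s) (h t)
  where
  negate : ∀ a b → - a - - b ≡ - (a - b)
  negate = solve-∀

∇-flip : ∀ s t h → ∇ (t , s) h ≡ - ∇ (s , t) h
∇-flip s t h = negate (h t) (h s)
  where
  negate : ∀ a b → a - b ≡ - (b - a)
  negate = solve-∀

column-flip : ∀ s t v → column (t , s) v ≡ - column (s , t) v
column-flip s t v = negate (δ t v) (δ s v)
  where
  negate : ∀ a b → a - b ≡ - (b - a)
  negate = solve-∀

flow-cong : ∀ A {x x′} → x ≗ x′ → ∀ v → flow A x v ≡ flow A x′ v
flow-cong []      x≗x′ v = refl
flow-cong (a ∷ A) x≗x′ v = cong₂ _+_ (cong (_* column a v) (x≗x′ 0)) (flow-cong A (x≗x′ ∘ suc) v)

pairing-cong : ∀ A {x x′ h h′} → x ≗ x′ → h ≗ h′ → pairing A x h ≡ pairing A x′ h′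
pairing-cong []      x≗x′ h≗h′ = refl
pairing-cong (a ∷ A) x≗x′ h≗h′ =
  cong₂ _+_ (cong₂ _*_ (x≗x′ 0) (∇-cong a h≗h′)) (pairing-cong A (x≗x′ ∘ suc) h≗h′)

upperForm-cong : ∀ A {x x′ y y′} → x ≗ x′ → y ≗ y′ → upperForm A x y ≡ upperForm A x′ y′
upperForm-cong []      x≗x′ y≗y′ = refl
upperForm-cong (a ∷ A) x≗x′ y≗y′ =
  cong₂ _+_ (cong₂ _+_ (cong₂ _*_ (x≗x′ 0) (y≗y′ 0))
                       (cong₂ _*_ (x≗x′ 0) (∇-cong a (flow-cong A (y≗y′ ∘ suc)))))
            (upperForm-cong A (x≗x′ ∘ suc) (y≗y′ ∘ suc))

prefixSum-cong : ∀ {g g′} → g ≗ g′ → prefixSum g ≗ prefixSum g′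
prefixSum-cong g≗g′ zero    = g≗g′ zero
prefixSum-cong g≗g′ (suc w) = cong₂ _+_ (prefixSum-cong g≗g′ w) (g≗g′ (suc w))

prefixSum-zero : prefixSum (λ _ → 0ℤ) ≗ (λ _ → 0ℤ)
prefixSum-zero zero    = refl
prefixSum-zero (suc w) = cong (_+ 0ℤ) (prefixSum-zero w)

prefixSum-+ : ∀ g g′ → prefixSum (λ v → g v + g′ v) ≗ (λ v → prefixSum g v + prefixSum g′ v)
prefixSum-+ g g′ zero    = refl
prefixSum-+ g g′ (suc w) =
  trans (cong (_+ (g (suc w) + g′ (suc w))) (prefixSum-+ g g′ w))
        (interchange (prefixSum g w) (prefixSum g′ w) (g (suc w)) (g′ (suc w)))
  where
  interchange : ∀ a b c d → a + b + (c + d) ≡ a + c + (b + d)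
  interchange = solve-∀

prefixSum-* : ∀ k g → prefixSum (λ v → k * g v) ≗ (λ v → k * prefixSum g v)
prefixSum-* k g zero    = refl
prefixSum-* k g (suc w) =
  trans (cong (_+ k * g (suc w)) (prefixSum-* k g w)) (sym (ℤP.*-distribˡ-+ k (prefixSum g w) (g (suc w))))

prefixSum-neg : ∀ g → prefixSum (λ v → - g v) ≗ (λ v → - prefixSum g v)
prefixSum-neg g zero    = refl
prefixSum-neg g (suc w) =
  trans (cong (_+ - g (suc w)) (prefixSum-neg g w)) (sym (ℤP.neg-distrib-+ (prefixSum g w) (g (suc w))))

pairing-+ : ∀ A x h h′ → pairing A x (λ v → h v + h′ v) ≡ pairing A x h + pairing A x h′
pairing-+ []      x h h′ = refl
pairing-+ (a ∷ A) x h h′ =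
  trans (cong₂ _+_ (trans (cong (x 0 *_) (∇-+ a h h′)) (ℤP.*-distribˡ-+ (x 0) (∇ a h) (∇ a h′)))
                   (pairing-+ A (x ∘ suc) h h′))
        (interchange (x 0 * ∇ a h) (x 0 * ∇ a h′) (pairing A (x ∘ suc) h) (pairing A (x ∘ suc) h′))
  where
  interchange : ∀ a b c d → a + b + (c + d) ≡ a + c + (b + d)
  interchange = solve-∀

pairing-* : ∀ A x k h → pairing A x (λ v → k * h v) ≡ k * pairing A x h
pairing-* []      x k h = sym (ℤP.*-zeroʳ k)
pairing-* (a ∷ A) x k h =
  trans (cong₂ _+_ (cong (x 0 *_) (∇-* a k h)) (pairing-* A (x ∘ suc) k h))
        (factor (x 0) k (∇ a h) (pairing A (x ∘ suc) h))
  where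
  factor : ∀ x k d p → x * (k * d) + k * p ≡ k * (x * d + p)
  factor = solve-∀

pairing-neg : ∀ A x h → pairing A x (λ v → - h v) ≡ - pairing A x h
pairing-neg []      x h = refl
pairing-neg (a ∷ A) x h =
  trans (cong₂ _+_ (cong (x 0 *_) (∇-neg a h)) (pairing-neg A (x ∘ suc) h))
        (factor (x 0) (∇ a h) (pairing A (x ∘ suc) h))
  where
  factor : ∀ x d p → x * - d + - p ≡ - (x * d + p)
  factor = solve-∀

pairing-const : ∀ A x k → pairing A x (λ _ → k) ≡ 0ℤ
pairing-const []      x k = refl
pairing-const (a ∷ A) x k =
  trans (cong₂ _+_ (trans (cong (x 0 *_) (ℤP.+-inverseʳ k)) (ℤP.*-zeroʳ (x 0))) (pairing-const A (x ∘ suc) k))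
        refl

flow-++ : ∀ A B x v → flow (A ++ B) x v ≡ flow A x v + flow B (shift (length A) x) v
flow-++ []      B x v = sym (ℤP.+-identityˡ _)
flow-++ (a ∷ A) B x v =
  trans (cong (x 0 * column a v +_) (flow-++ A B (x ∘ suc) v))
        (sym (ℤP.+-assoc (x 0 * column a v) _ _))

pairing-++ : ∀ A B x h → pairing (A ++ B) x h ≡ pairing A x h + pairing B (shift (length A) x) h
pairing-++ []      B x h = sym (ℤP.+-identityˡ _)
pairing-++ (a ∷ A) B x h =
  trans (cong (x 0 * ∇ a h +_) (pairing-++ A B (x ∘ suc) h))
        (sym (ℤP.+-assoc (x 0 * ∇ a h) _ _))

upperForm-++ : ∀ A B x y →
  upperForm (A ++ B) x y
    ≡ upperForm A x y + pairing A x (flow B (shift (length A) y)) + upperForm B (shift (length A) x) (shift (length A) y)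
upperForm-++ []      B x y = sym (ℤP.+-identityˡ _)
upperForm-++ (a ∷ A) B x y =
  trans (cong₂ _+_ (cong (λ z → x 0 * y 0 + x 0 * z)
                         (trans (∇-cong a (flow-++ A B (y ∘ suc)))
                                (∇-+ a (flow A (y ∘ suc)) (flow B (shift (length A) (y ∘ suc))))))
                   (upperForm-++ A B (x ∘ suc) (y ∘ suc)))
        (rearrange (x 0) (y 0) _ _ _ _ _)
  where
  rearrange : ∀ x₀ y₀ d₁ d₂ u p w →
    x₀ * y₀ + x₀ * (d₁ + d₂) + (u + p + w) ≡ x₀ * y₀ + x₀ * d₁ + u + (x₀ * d₂ + p) + w
  rearrange = solve-∀

prefixSum-δ : ∀ s w → prefixSum (δ s) w ≡ heaviside s w
prefixSum-δ zero    zero = trans (δ-refl 0) (sym (heaviside-≤ 0 0 z≤n))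
prefixSum-δ (suc s) zero = trans (δ-≢ (suc s) 0 (λ ())) (sym (heaviside-≰ (suc s) 0 (λ ())))
prefixSum-δ s (suc w) with s ≤? w
... | yes s≤w =
  trans (cong₂ _+_ (trans (prefixSum-δ s w) (heaviside-≤ s w s≤w))
                   (δ-≢ s (suc w) (λ s≡1+w → ℕP.<-irrefl s≡1+w (s≤s s≤w))))
        (sym (heaviside-≤ s (suc w) (ℕP.m≤n⇒m≤1+n s≤w)))
... | no s≰w with s ℕ.≟ suc w
...   | yes refl =
  trans (cong₂ _+_ (trans (prefixSum-δ (suc w) w) (heaviside-≰ (suc w) w s≰w)) (δ-refl (suc w)))
        (sym (heaviside-≤ (suc w) (suc w) ℕP.≤-refl))
...   | no s≢1+w =
  trans (cong₂ _+_ (trans (prefixSum-δ s w) (heaviside-≰ s w s≰w)) (δ-≢ s (suc w) s≢1+w))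
        (sym (heaviside-≰ s (suc w) (λ s≤1+w → s≢1+w (ℕP.≤-antisym s≤1+w (ℕP.≰⇒> s≰w)))))

prefixSum-column : ∀ s t → prefixSum (column (s , t)) ≗ (λ v → heaviside s v - heaviside t v)
prefixSum-column s t v =
  trans (prefixSum-+ (δ s) (λ v → - δ t v) v)
        (cong₂ _+_ (prefixSum-δ s v) (trans (prefixSum-neg (δ t) v) (cong -_ (prefixSum-δ t v))))

∇-prefixSum-column : ∀ s t → s ≢ t → ∇ (s , t) (prefixSum (column (s , t))) ≡ 1ℤ
∇-prefixSum-column s t s≢t with ℕP.≤-total s t
... | inj₁ s≤t =
  cong₂ _-_ (trans (prefixSum-column s t s)
                   (cong₂ _-_ (heaviside-≤ s s ℕP.≤-refl) (heaviside-≰ t s (s≢t ∘ ℕP.≤-antisym s≤t))))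
            (trans (prefixSum-column s t t) (cong₂ _-_ (heaviside-≤ s t s≤t) (heaviside-≤ t t ℕP.≤-refl)))
... | inj₂ t≤s =
  cong₂ _-_ (trans (prefixSum-column s t s) (cong₂ _-_ (heaviside-≤ s s ℕP.≤-refl) (heaviside-≤ t s t≤s)))
            (trans (prefixSum-column s t t)
                   (cong₂ _-_ (heaviside-≰ s t (λ s≤t → s≢t (ℕP.≤-antisym s≤t t≤s))) (heaviside-≤ t t ℕP.≤-refl)))

∇-prefixSum-*column : ∀ s t k → s ≢ t → ∇ (s , t) (prefixSum (λ v → k * column (s , t) v)) ≡ k
∇-prefixSum-*column s t k s≢t =
  trans (∇-cong (s , t) (prefixSum-* k (column (s , t))))
        (trans (∇-* (s , t) k (prefixSum (column (s , t))))
               (trans (cong (k *_) (∇-prefixSum-column s t s≢t)) (ℤP.*-identityʳ k)))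

∇-column : ∀ s t → s ≢ t → ∇ (s , t) (column (s , t)) ≡ ℤ.+ 2
∇-column s t s≢t =
  cong₂ _-_ (cong₂ _-_ (δ-refl s) (δ-≢ t s (s≢t ∘ sym))) (cong₂ _-_ (δ-≢ s t s≢t) (δ-refl t))

correctedForm-∷ : ∀ s t B x y → s ≢ t →
  correctedForm ((s , t) ∷ B) x y
    ≡ correctedForm B (x ∘ suc) (y ∘ suc) + x 0 * ∇ (s , t) (prefixSum (flow B (y ∘ suc)))
      + y 0 * (pairing B (x ∘ suc) (prefixSum (column (s , t))) - pairing B (x ∘ suc) (column (s , t)))
correctedForm-∷ s t B x y s≢t = begin
  correctedForm (a ∷ B) x y
    ≡⟨⟩
  (x 0 * ∇ a (prefixSum F) + pairing B x′ (prefixSum F)) - (x 0 * ∇ a F + pairing B x′ F)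
    + upperForm (a ∷ B) x y
    ≡⟨ cong₂ (λ p q → p - q + upperForm (a ∷ B) x y)
             (cong₂ _+_ (cong (x 0 *_) ∇ΣF) pairingΣF) (cong₂ _+_ (cong (x 0 *_) ∇F) pairingF) ⟩
  (x 0 * (y 0 * 1ℤ + ∇ a (prefixSum g)) + (y 0 * pairing B x′ (prefixSum (column a)) + pairing B x′ (prefixSum g)))
    - (x 0 * (y 0 * ℤ.+ 2 + ∇ a g) + (y 0 * pairing B x′ (column a) + pairing B x′ g))
    + (x 0 * y 0 + x 0 * ∇ a g + upperForm B x′ y′)
    ≡⟨ rearrange (x 0) (y 0) _ _ _ _ _ _ _ ⟩
  correctedForm B x′ y′ + x 0 * ∇ a (prefixSum g)
    + y 0 * (pairing B x′ (prefixSum (column a)) - pairing B x′ (column a)) ∎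
  where
  open ≡-Reasoning
  a : Arrow
  a = (s , t)
  x′ y′ : Seq
  x′ = x ∘ suc
  y′ = y ∘ suc
  g F : ℕ → ℤ
  g = flow B y′
  F = flow (a ∷ B) y
  ΣF : prefixSum F ≗ (λ v → y 0 * prefixSum (column a) v + prefixSum g v)
  ΣF v = trans (prefixSum-+ (λ v → y 0 * column a v) g v) (cong (_+ prefixSum g v) (prefixSum-* (y 0) (column a) v))
  ∇ΣF : ∇ a (prefixSum F) ≡ y 0 * 1ℤ + ∇ a (prefixSum g)
  ∇ΣF = trans (∇-cong a ΣF)
              (trans (∇-+ a (λ v → y 0 * prefixSum (column a) v) (prefixSum g))
                     (cong (_+ ∇ a (prefixSum g))
                           (trans (∇-* a (y 0) (prefixSum (column a))) (cong (y 0 *_) (∇-prefixSum-column s t s≢t)))))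
  pairingΣF : pairing B x′ (prefixSum F) ≡ y 0 * pairing B x′ (prefixSum (column a)) + pairing B x′ (prefixSum g)
  pairingΣF = trans (pairing-cong B (λ _ → refl) ΣF)
                    (trans (pairing-+ B x′ (λ v → y 0 * prefixSum (column a) v) (prefixSum g))
                           (cong (_+ pairing B x′ (prefixSum g)) (pairing-* B x′ (y 0) (prefixSum (column a)))))
  ∇F : ∇ a F ≡ y 0 * ℤ.+ 2 + ∇ a g
  ∇F = trans (∇-+ a (λ v → y 0 * column a v) g)
             (cong (_+ ∇ a g) (trans (∇-* a (y 0) (column a)) (cong (y 0 *_) (∇-column s t s≢t))))
  pairingF : pairing B x′ F ≡ y 0 * pairing B x′ (column a) + pairing B x′ g
  pairingF = trans (pairing-+ B x′ (λ v → y 0 * column a v) g) (cong (_+ pairing B x′ g) (pairing-* B x′ (y 0) (column a)))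
  rearrange : ∀ x₀ y₀ dΣg pΣc pΣg dg pc pg u →
    (x₀ * (y₀ * 1ℤ + dΣg) + (y₀ * pΣc + pΣg)) - (x₀ * (y₀ * ℤ.+ 2 + dg) + (y₀ * pc + pg)) + (x₀ * y₀ + x₀ * dg + u)
    ≡ pΣg - pg + u + x₀ * dΣg + y₀ * (pΣc - pc)
  rearrange = solve-∀

AllVertices : (ℕ → Set) → List Arrow → Set
AllVertices P = All (λ a → P (proj₁ a) × P (proj₂ a))

AllVertices-map : ∀ {P Q : ℕ → Set} → (∀ {u} → P u → Q u) → ∀ {A} → AllVertices P A → AllVertices Q A
AllVertices-map f = All.map (λ (p , q) → f p , f q)

IsVertex : ℕ → ℕ → Set
IsVertex m u = 1 ≤ u × u ≤ m

flow-outside : ∀ A x v → AllVertices (_≢ v) A → flow A x v ≡ 0ℤ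
flow-outside []            x v []                   = refl
flow-outside ((s , t) ∷ A) x v ((s≢v , t≢v) ∷ ends) =
  trans (cong₂ _+_ (cong (x 0 *_) (cong₂ _-_ (δ-≢ s v s≢v) (δ-≢ t v t≢v))) (flow-outside A (x ∘ suc) v ends))
        (trans (ℤP.+-identityʳ _) (ℤP.*-zeroʳ (x 0)))

pairing-congᵛ : ∀ A x {h h′} → AllVertices (λ u → h u ≡ h′ u) A → pairing A x h ≡ pairing A x h′
pairing-congᵛ []            x []                 = refl
pairing-congᵛ ((s , t) ∷ A) x ((hs , ht) ∷ ends) =
  cong₂ _+_ (cong (x 0 *_) (cong₂ _-_ hs ht)) (pairing-congᵛ A (x ∘ suc) ends)

∑-δ*-below : ∀ m k s (F : ℕ → ℤ) → s < k → ∑ {m} (λ i → δ s (k ℕ.+ toℕ i) * F (k ℕ.+ toℕ i)) ≡ 0ℤ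
∑-δ*-below m k s F s<k = ∑-zero {m} λ i →
  trans (cong (_* F (k ℕ.+ toℕ i)) (δ-≢ s _ (λ s≡ → ℕP.<-irrefl s≡ (ℕP.<-≤-trans s<k (ℕP.m≤m+n k (toℕ i))))))
        (ℤP.*-zeroˡ (F (k ℕ.+ toℕ i)))

∑-δ* : ∀ m k s (F : ℕ → ℤ) → k ≤ s → s < k ℕ.+ m →
  ∑ {m} (λ i → δ s (k ℕ.+ toℕ i) * F (k ℕ.+ toℕ i)) ≡ F s
∑-δ* zero    k s F k≤s s<k+0 =
  ⊥-elim (ℕP.<-irrefl refl (ℕP.<-≤-trans s<k+0 (subst (_≤ s) (sym (ℕP.+-identityʳ k)) k≤s)))
∑-δ* (suc m) k s F k≤s s<k+m = trans (cong₂ _+_ first (∑-cong {m} shiftIndex)) rest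
  where
  shiftIndex : ∀ i → δ s (k ℕ.+ suc (toℕ i)) * F (k ℕ.+ suc (toℕ i)) ≡ δ s (suc k ℕ.+ toℕ i) * F (suc k ℕ.+ toℕ i)
  shiftIndex i = cong (λ u → δ s u * F u) (ℕP.+-suc k (toℕ i))
  first : δ s (k ℕ.+ 0) * F (k ℕ.+ 0) ≡ δ s k * F k
  first = cong (λ u → δ s u * F u) (ℕP.+-identityʳ k)
  rest : δ s k * F k + ∑ {m} (λ i → δ s (suc k ℕ.+ toℕ i) * F (suc k ℕ.+ toℕ i)) ≡ F s
  rest with k ℕ.≟ s
  ... | yes refl = trans (cong₂ _+_ (trans (cong (_* F k) (δ-refl k)) (ℤP.*-identityˡ (F k)))
                                    (∑-δ*-below m (suc k) k F ℕP.≤-refl))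
                         (ℤP.+-identityʳ (F k))
  ... | no k≢s   = trans (cong₂ _+_ (trans (cong (_* F k) (δ-≢ s k (k≢s ∘ sym))) (ℤP.*-zeroˡ (F k)))
                                    (∑-δ* m (suc k) s F (ℕP.≤∧≢⇒< k≤s k≢s) (subst (s <_) (ℕP.+-suc k m) s<k+m)))
                         (ℤP.+-identityˡ (F s))

∑-column* : ∀ m a (h : ℕ → ℤ) → IsVertex m (proj₁ a) → IsVertex m (proj₂ a) →
  ∑ {m} (λ i → column a (suc (toℕ i)) * h (suc (toℕ i))) ≡ ∇ a h
∑-column* m (s , t) h (1≤s , s≤m) (1≤t , t≤m) =
  trans (∑-cong {m} (λ i → ℤP.*-distribʳ-+ (h (suc (toℕ i))) (δ s (suc (toℕ i))) (- δ t (suc (toℕ i)))))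
        (trans (∑-+ {m} (λ i → δ s (suc (toℕ i)) * h (suc (toℕ i))) (λ i → - δ t (suc (toℕ i)) * h (suc (toℕ i))))
               (cong₂ _+_ (∑-δ* m 1 s h 1≤s (s≤s s≤m))
                          (trans (∑-cong {m} (λ i → sym (ℤP.neg-distribˡ-* (δ t (suc (toℕ i))) (h (suc (toℕ i))))))
                                 (trans (∑-neg {m} (λ i → δ t (suc (toℕ i)) * h (suc (toℕ i))))
                                        (cong -_ (∑-δ* m 1 t h 1≤t (s≤s t≤m)))))))

pairing-transpose : ∀ m A x h → AllVertices (IsVertex m) A →
  pairing A x h ≡ ∑ {m} (λ i → flow A x (suc (toℕ i)) * h (suc (toℕ i)))
pairing-transpose m []      x h []                  = sym (∑-zero {m} (λ i → ℤP.*-zeroˡ (h (suc (toℕ i)))))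
pairing-transpose m (a ∷ A) x h ((s , t) ∷ vertices) = sym (begin
  ∑ {m} (λ i → (x 0 * column a (vertex i) + flow A (x ∘ suc) (vertex i)) * h (vertex i))
    ≡⟨ ∑-cong {m} (λ i → distrib (x 0) (column a (vertex i)) (flow A (x ∘ suc) (vertex i)) (h (vertex i))) ⟩
  ∑ {m} (λ i → x 0 * (column a (vertex i) * h (vertex i)) + flow A (x ∘ suc) (vertex i) * h (vertex i))
    ≡⟨ ∑-+ {m} (λ i → x 0 * (column a (vertex i) * h (vertex i))) (λ i → flow A (x ∘ suc) (vertex i) * h (vertex i)) ⟩
  ∑ {m} (λ i → x 0 * (column a (vertex i) * h (vertex i))) + ∑ {m} (λ i → flow A (x ∘ suc) (vertex i) * h (vertex i))
    ≡⟨ cong₂ _+_ (trans (∑-*ˡ (x 0) (λ i → column a (vertex i) * h (vertex i))) (cong (x 0 *_) (∑-column* m a h s t)))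
                 (sym (pairing-transpose m A (x ∘ suc) h vertices)) ⟩
  x 0 * ∇ a h + pairing A (x ∘ suc) h ∎)
  where
  open ≡-Reasoning
  vertex : Fin m → ℕ
  vertex i = suc (toℕ i)
  distrib : ∀ x₀ c f h → (x₀ * c + f) * h ≡ x₀ * (c * h) + f * h
  distrib = solve-∀

pairing-zeroFlow : ∀ m A x h → AllVertices (IsVertex m) A → (∀ v → flow A x v ≡ 0ℤ) → pairing A x h ≡ 0ℤ
pairing-zeroFlow m A x h vertices flow≡0 =
  trans (pairing-transpose m A x h vertices)
        (∑-zero {m} λ i → trans (cong (_* h (suc (toℕ i))) (flow≡0 (suc (toℕ i)))) (ℤP.*-zeroˡ (h (suc (toℕ i)))))

-- Paths, chains and parallel arrows

path : ℕ → ℕ → List Arrow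
path b zero    = []
path b (suc k) = (b , suc b) ∷ path (suc b) k

length-path : ∀ b k → length (path b k) ≡ k
length-path b zero    = refl
length-path b (suc k) = cong suc (length-path (suc b) k)

path-above : ∀ b k → AllVertices (b ≤_) (path b k)
path-above b zero    = []
path-above b (suc k) = (ℕP.≤-refl , ℕP.n≤1+n b) ∷ AllVertices-map (ℕP.≤-trans (ℕP.n≤1+n b)) (path-above (suc b) k)

-- On a path the prefix sums of a column are the step functions, which are constant
-- on the rest of the path: this is what makes the form telescope.
upperForm-path : ∀ b k x y → upperForm (path b k) x y ≡ pairing (path b k) x (prefixSum (flow (path b k) y))
upperForm-path b zero    x y = refl
upperForm-path b (suc k) x y = begin
  x 0 * y 0 + x 0 * ∇ a g + upperForm B x′ y′
    ≡⟨ cong₂ _+_ (cong (λ z → x 0 * y 0 + x 0 * z) ∇g) (upperForm-path (suc b) k x′ y′) ⟩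
  x 0 * y 0 + x 0 * (0ℤ - g (suc b)) + pairing B x′ (prefixSum g)
    ≡⟨ rearrange (x 0) (y 0) (g (suc b)) (pairing B x′ (prefixSum g)) ⟩
  x 0 * (y 0 * 1ℤ + (0ℤ - g (suc b))) + (y 0 * 0ℤ + pairing B x′ (prefixSum g))
    ≡⟨ sym (cong₂ _+_ (cong (x 0 *_) ∇ΣF) pairingΣF) ⟩
  x 0 * ∇ a (prefixSum F) + pairing B x′ (prefixSum F) ∎
  where
  open ≡-Reasoning
  a : Arrow
  a = (b , suc b)
  B = path (suc b) k
  x′ y′ : Seq
  x′ = x ∘ suc
  y′ = y ∘ suc
  g F : ℕ → ℤ
  g = flow B y′
  F = flow (a ∷ B) y
  ∇g : ∇ a g ≡ 0ℤ - g (suc b)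
  ∇g = cong (_- g (suc b))
             (flow-outside B y′ b (AllVertices-map (λ b<u b≡u → ℕP.<-irrefl (sym b≡u) b<u) (path-above (suc b) k)))
  ΣF : prefixSum F ≗ (λ v → y 0 * prefixSum (column a) v + prefixSum g v)
  ΣF v = trans (prefixSum-+ (λ v → y 0 * column a v) g v) (cong (_+ prefixSum g v) (prefixSum-* (y 0) (column a) v))
  ∇Σg : ∇ a (prefixSum g) ≡ 0ℤ - g (suc b)
  ∇Σg = telescope (prefixSum g b) (g (suc b))
    where
    telescope : ∀ p q → p - (p + q) ≡ 0ℤ - q
    telescope = solve-∀
  ∇ΣF : ∇ a (prefixSum F) ≡ y 0 * 1ℤ + (0ℤ - g (suc b))
  ∇ΣF = trans (∇-cong a ΣF)
              (trans (∇-+ a (λ v → y 0 * prefixSum (column a) v) (prefixSum g))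
                     (cong₂ _+_ (trans (∇-* a (y 0) (prefixSum (column a)))
                                       (cong (y 0 *_) (∇-prefixSum-column b (suc b) (ℕP.1+n≢n ∘ sym))))
                                ∇Σg))
  Σcolumn≡0 : AllVertices (λ u → prefixSum (column a) u ≡ 0ℤ) B
  Σcolumn≡0 = AllVertices-map
    (λ {u} 1+b≤u → trans (prefixSum-column b (suc b) u)
                         (trans (cong₂ _-_ (heaviside-≤ b u (ℕP.≤-trans (ℕP.n≤1+n b) 1+b≤u))
                                           (heaviside-≤ (suc b) u 1+b≤u))
                                refl))
    (path-above (suc b) k)
  pairingΣF : pairing B x′ (prefixSum F) ≡ y 0 * 0ℤ + pairing B x′ (prefixSum g)
  pairingΣF =
    trans (pairing-cong B (λ _ → refl) ΣF)
          (trans (pairing-+ B x′ (λ v → y 0 * prefixSum (column a) v) (prefixSum g))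
                 (cong (_+ pairing B x′ (prefixSum g))
                       (trans (pairing-* B x′ (y 0) (prefixSum (column a)))
                              (cong (y 0 *_) (trans (pairing-congᵛ B x′ Σcolumn≡0) (pairing-const B x′ 0ℤ))))))
  rearrange : ∀ x₀ y₀ g₁ p → x₀ * y₀ + x₀ * (0ℤ - g₁) + p ≡ x₀ * (y₀ * 1ℤ + (0ℤ - g₁)) + (y₀ * 0ℤ + p)
  rearrange = solve-∀

+≡0⇒≡neg : ∀ a b → a + b ≡ 0ℤ → a ≡ - b
+≡0⇒≡neg a b a+b≡0 = trans (sym (ℤP.+-identityʳ a))
  (trans (cong (a +_) (sym (ℤP.+-inverseʳ b)))
  (trans (sym (ℤP.+-assoc a b (- b))) (trans (cong (_+ - b) a+b≡0) (ℤP.+-identityˡ (- b)))))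

upperForm-afterPath : ∀ m k N x y → AllVertices (IsVertex m) (path 1 k ++ N) →
  (∀ v → flow (path 1 k ++ N) x v ≡ 0ℤ) → (∀ v → flow (path 1 k ++ N) y v ≡ 0ℤ) →
  upperForm (path 1 k ++ N) x y ≡ correctedForm N (shift k x) (shift k y)
upperForm-afterPath m k N x y vertices flowx≡0 flowy≡0 = begin
  upperForm (T ++ N) x y
    ≡⟨ upperForm-++ T N x y ⟩
  upperForm T x y + pairing T x (flow N (shift ℓ y)) + upperForm N (shift ℓ x) (shift ℓ y)
    ≡⟨ cong₂ _+_ (cong₂ _+_ upperFormT pairingT) (upperForm-cong N shiftx shifty) ⟩
  - - pairing N x₁ (prefixSum fN) + - pairing N x₁ fN + upperForm N x₁ y₁
    ≡⟨ cong (λ z → z + - pairing N x₁ fN + upperForm N x₁ y₁) (ℤP.neg-involutive (pairing N x₁ (prefixSum fN))) ⟩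
  correctedForm N x₁ y₁ ∎
  where
  open ≡-Reasoning
  T = path 1 k
  ℓ = length T
  x₁ y₁ : Seq
  x₁ = shift k x
  y₁ = shift k y
  shiftx : shift ℓ x ≗ x₁
  shiftx i = cong (λ n → x (n ℕ.+ i)) (length-path 1 k)
  shifty : shift ℓ y ≗ y₁
  shifty i = cong (λ n → y (n ℕ.+ i)) (length-path 1 k)
  fN : ℕ → ℤ
  fN = flow N y₁
  flowT : flow T y ≗ (λ v → - fN v)
  flowT v = trans (+≡0⇒≡neg _ _ (trans (sym (flow-++ T N y v)) (flowy≡0 v))) (cong -_ (flow-cong N shifty v))
  pairingT≡ : ∀ h → pairing T x h ≡ - pairing N x₁ h
  pairingT≡ h = trans (+≡0⇒≡neg _ _ (trans (sym (pairing-++ T N x h)) (pairing-zeroFlow m (T ++ N) x h vertices flowx≡0)))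
                      (cong -_ (pairing-cong N shiftx (λ _ → refl)))
  upperFormT : upperForm T x y ≡ - - pairing N x₁ (prefixSum fN)
  upperFormT = trans (upperForm-path 1 k x y)
    (trans (pairing-cong T (λ _ → refl) (λ v → trans (prefixSum-cong flowT v) (prefixSum-neg fN v)))
           (trans (pairing-neg T x (prefixSum fN)) (cong -_ (pairingT≡ (prefixSum fN)))))
  pairingT : pairing T x (flow N (shift ℓ y)) ≡ - pairing N x₁ fN
  pairingT = trans (pairing-cong T (λ _ → refl) (flow-cong N shifty)) (pairingT≡ fN)

chain : (ℕ → ℕ) → ℕ → List Arrow
chain w zero    = []
chain w (suc r) = (w 0 , w 1) ∷ chain (w ∘ suc) r

length-chain : ∀ w r → length (chain w r) ≡ r
length-chain w zero    = refl
length-chain w (suc r) = cong suc (length-chain (w ∘ suc) r)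

StrictlyDecreasing : (ℕ → ℕ) → ℕ → Set
StrictlyDecreasing w r = ∀ i → i < r → w (suc i) < w i

StrictlyDecreasing-tail : ∀ w r → StrictlyDecreasing w (suc r) → StrictlyDecreasing (w ∘ suc) r
StrictlyDecreasing-tail w r dec i i<r = dec (suc i) (s≤s i<r)

StrictlyDecreasing-last≤ : ∀ w r → StrictlyDecreasing w r → w r ≤ w 0
StrictlyDecreasing-last≤ w zero    dec = ℕP.≤-refl
StrictlyDecreasing-last≤ w (suc r) dec =
  ℕP.≤-trans (StrictlyDecreasing-last≤ (w ∘ suc) r (StrictlyDecreasing-tail w r dec)) (ℕP.<⇒≤ (dec 0 (s≤s z≤n)))

chain-below : ∀ w r → StrictlyDecreasing w r → AllVertices (_≤ w 0) (chain w r)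
chain-below w zero    dec = []
chain-below w (suc r) dec =
  (ℕP.≤-refl , ℕP.<⇒≤ w₁<w₀)
  ∷ AllVertices-map (λ u≤w₁ → ℕP.≤-trans u≤w₁ (ℕP.<⇒≤ w₁<w₀))
                    (chain-below (w ∘ suc) r (StrictlyDecreasing-tail w r dec))
  where
  w₁<w₀ = dec 0 (s≤s z≤n)

prefixSum-constantAbove : ∀ (g : ℕ → ℤ) u → (∀ v → u < v → g v ≡ 0ℤ) →
  ∀ k → prefixSum g (k ℕ.+ u) ≡ prefixSum g u
prefixSum-constantAbove g u g≡0 zero    = refl
prefixSum-constantAbove g u g≡0 (suc k) =
  trans (cong (prefixSum g (k ℕ.+ u) +_) (g≡0 (suc (k ℕ.+ u)) (s≤s (ℕP.m≤n+m u k))))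
        (trans (ℤP.+-identityʳ _) (prefixSum-constantAbove g u g≡0 k))

-- An arrow w₀ → w₁ followed only by arrows below w₁ contributes nothing to the corrected form:
-- the potential of the remaining flow is constant above w₁, and the step function of the
-- arrow agrees with its column below w₁.
correctedForm-chain : ∀ r w P x y → StrictlyDecreasing w r → AllVertices (_≤ w r) P →
  correctedForm (chain w r ++ P) x y ≡ correctedForm P (shift r x) (shift r y)
correctedForm-chain zero    w P x y dec belowP = refl
correctedForm-chain (suc r) w P x y dec belowP = begin
  correctedForm ((w 0 , w 1) ∷ R) x y
    ≡⟨ correctedForm-∷ (w 0) (w 1) R x y w₀≢w₁ ⟩
  correctedForm R (x ∘ suc) (y ∘ suc) + x 0 * ∇ a (prefixSum g)
    + y 0 * (pairing R (x ∘ suc) (prefixSum (column a)) - pairing R (x ∘ suc) (column a))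
    ≡⟨ cong₂ _+_ (cong₂ _+_ (correctedForm-chain r (w ∘ suc) P (x ∘ suc) (y ∘ suc) dec′ belowP) (cong (x 0 *_) ∇Σg))
                 (cong (λ z → y 0 * (z - pairing R (x ∘ suc) (column a))) (pairing-congᵛ R (x ∘ suc) Σcolumn≡column)) ⟩
  correctedForm P (shift (suc r) x) (shift (suc r) y) + x 0 * 0ℤ
    + y 0 * (pairing R (x ∘ suc) (column a) - pairing R (x ∘ suc) (column a))
    ≡⟨ vanish (correctedForm P (shift (suc r) x) (shift (suc r) y)) (x 0) (y 0) (pairing R (x ∘ suc) (column a)) ⟩
  correctedForm P (shift (suc r) x) (shift (suc r) y) ∎
  where
  open ≡-Reasoning
  a : Arrow
  a = (w 0 , w 1)
  R = chain (w ∘ suc) r ++ P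
  dec′ = StrictlyDecreasing-tail w r dec
  w₁<w₀ : w 1 < w 0
  w₁<w₀ = dec 0 (s≤s z≤n)
  w₀≢w₁ : w 0 ≢ w 1
  w₀≢w₁ w₀≡w₁ = ℕP.<-irrefl (sym w₀≡w₁) w₁<w₀
  belowR : AllVertices (_≤ w 1) R
  belowR = ++⁺ (chain-below (w ∘ suc) r dec′)
               (AllVertices-map (λ u≤ → ℕP.≤-trans u≤ (StrictlyDecreasing-last≤ (w ∘ suc) r dec′)) belowP)
  g : ℕ → ℤ
  g = flow R (y ∘ suc)
  ∇Σg : ∇ a (prefixSum g) ≡ 0ℤ
  ∇Σg = trans (cong (_- prefixSum g (w 1))
                    (trans (cong (prefixSum g) (sym (ℕP.m∸n+n≡m (ℕP.<⇒≤ w₁<w₀))))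
                           (prefixSum-constantAbove g (w 1) g≡0 (w 0 ℕ.∸ w 1))))
              (ℤP.+-inverseʳ (prefixSum g (w 1)))
    where
    g≡0 : ∀ v → w 1 < v → g v ≡ 0ℤ
    g≡0 v w₁<v = flow-outside R (y ∘ suc) v
      (AllVertices-map (λ u≤w₁ u≡v → ℕP.<-irrefl u≡v (ℕP.≤-<-trans u≤w₁ w₁<v)) belowR)
  Σcolumn≡column : AllVertices (λ u → prefixSum (column a) u ≡ column a u) R
  Σcolumn≡column = AllVertices-map agree belowR
    where
    agree : ∀ {u} → u ≤ w 1 → prefixSum (column a) u ≡ column a u
    agree {u} u≤w₁ =
      trans (prefixSum-column (w 0) (w 1) u)
            (cong₂ _-_ (heaviside≡δ (w 0) u (ℕP.≤-trans u≤w₁ (ℕP.<⇒≤ w₁<w₀))) (heaviside≡δ (w 1) u u≤w₁))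
  vanish : ∀ c x₀ y₀ p → c + x₀ * 0ℤ + y₀ * (p - p) ≡ c
  vanish = solve-∀

parallelClass : Arrow → ℕ → List Arrow
parallelClass α d = α ∷ kArrows α d

netMultiplicity : ℕ → Seq → ℤ
netMultiplicity zero    x = x 0
netMultiplicity (suc d) x = x 0 - x 1 + netMultiplicity d (x ∘ suc ∘ suc)

-- The value of the corrected form on the parallel class (correctedForm-parallel).
parallelForm : ℕ → Seq → Seq → ℤ
parallelForm zero    x y = 0ℤ
parallelForm (suc d) x y =
  parallelForm d x″ y″ - x 1 * netMultiplicity d y″ + y 1 * netMultiplicity d x″
  + x 0 * (netMultiplicity d y″ - y 1) + y 0 * (x 1 - netMultiplicity d x″)
  where
  x″ y″ : Seq
  x″ = x ∘ suc ∘ suc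
  y″ = y ∘ suc ∘ suc

flow-parallel : ∀ s t d x v → flow (parallelClass (s , t) d) x v ≡ netMultiplicity d x * column (s , t) v
flow-parallel s t zero    x v = ℤP.+-identityʳ _
flow-parallel s t (suc d) x v =
  trans (cong₂ (λ c f → x 0 * column (s , t) v + (x 1 * c + f)) (column-flip s t v) (flow-parallel s t d (x ∘ suc ∘ suc) v))
        (factor (x 0) (x 1) (netMultiplicity d (x ∘ suc ∘ suc)) (column (s , t) v))
  where
  factor : ∀ a b p c → a * c + (b * - c + p * c) ≡ (a - b + p) * c
  factor = solve-∀

pairing-parallel : ∀ s t d x h → pairing (parallelClass (s , t) d) x h ≡ netMultiplicity d x * ∇ (s , t) h
pairing-parallel s t zero    x h = ℤP.+-identityʳ _
pairing-parallel s t (suc d) x h =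
  trans (cong₂ (λ c f → x 0 * ∇ (s , t) h + (x 1 * c + f)) (∇-flip s t h) (pairing-parallel s t d (x ∘ suc ∘ suc) h))
        (factor (x 0) (x 1) (netMultiplicity d (x ∘ suc ∘ suc)) (∇ (s , t) h))
  where
  factor : ∀ a b p c → a * c + (b * - c + p * c) ≡ (a - b + p) * c
  factor = solve-∀

correctedForm-parallel : ∀ s t d x y → s ≢ t → correctedForm (parallelClass (s , t) d) x y ≡ parallelForm d x y
correctedForm-parallel s t zero x y s≢t =
  trans (correctedForm-∷ s t [] x y s≢t)
        (trans (cong (λ z → 0ℤ + x 0 * z + y 0 * (0ℤ - 0ℤ)) (∇-cong (s , t) prefixSum-zero)) (vanish (x 0) (y 0)))
  where
  vanish : ∀ a b → 0ℤ + a * (0ℤ - 0ℤ) + b * (0ℤ - 0ℤ) ≡ 0ℤ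
  vanish = solve-∀
correctedForm-parallel s t (suc d) x y s≢t = begin
  correctedForm (α ∷ R) x y
    ≡⟨ correctedForm-∷ s t R x y s≢t ⟩
  correctedForm R x′ y′ + x 0 * ∇ α (prefixSum (flow R y′))
    + y 0 * (pairing R x′ (prefixSum (column α)) - pairing R x′ (column α))
    ≡⟨ cong₂ _+_ (cong₂ _+_ correctedFormR (cong (x 0 *_) ∇ΣflowR))
                 (cong (y 0 *_) (cong₂ _-_ (pairingR (prefixSum (column α))) (pairingR (column α)))) ⟩
  parallelForm d x″ y″ + x 1 * (Sy * -1ℤ) + y 1 * (Sx * -1ℤ - Sx * - ℤ.+ 2) + x 0 * (Sy - y 1)
    + y 0 * ((x 1 * - ∇ α (prefixSum (column α)) + Sx * ∇ α (prefixSum (column α)))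
             - (x 1 * - ∇ α (column α) + Sx * ∇ α (column α)))
    ≡⟨ cong₂ (λ p q → parallelForm d x″ y″ + x 1 * (Sy * -1ℤ) + y 1 * (Sx * -1ℤ - Sx * - ℤ.+ 2) + x 0 * (Sy - y 1)
                       + y 0 * ((x 1 * - p + Sx * p) - (x 1 * - q + Sx * q)))
             (∇-prefixSum-column s t s≢t) (∇-column s t s≢t) ⟩
  parallelForm d x″ y″ + x 1 * (Sy * -1ℤ) + y 1 * (Sx * -1ℤ - Sx * - ℤ.+ 2) + x 0 * (Sy - y 1)
    + y 0 * ((x 1 * - 1ℤ + Sx * 1ℤ) - (x 1 * - ℤ.+ 2 + Sx * ℤ.+ 2))
    ≡⟨ rearrange (parallelForm d x″ y″) (x 0) (x 1) (y 0) (y 1) Sx Sy ⟩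
  parallelForm (suc d) x y ∎
  where
  open ≡-Reasoning
  α : Arrow
  α = (s , t)
  R = (t , s) ∷ parallelClass α d
  x′ y′ x″ y″ : Seq
  x′ = x ∘ suc
  y′ = y ∘ suc
  x″ = x ∘ suc ∘ suc
  y″ = y ∘ suc ∘ suc
  Sx Sy : ℤ
  Sx = netMultiplicity d x″
  Sy = netMultiplicity d y″
  t≢s : t ≢ s
  t≢s = s≢t ∘ sym
  ∇ΣflowPd : ∇ (t , s) (prefixSum (flow (parallelClass α d) y″)) ≡ Sy * -1ℤ
  ∇ΣflowPd =
    trans (∇-cong (t , s) (prefixSum-cong (flow-parallel s t d y″)))
          (trans (∇-flip s t (prefixSum (λ v → Sy * column α v)))
                 (trans (cong -_ (∇-prefixSum-*column s t Sy s≢t)) (trans (sym (ℤP.-1*i≡-i Sy)) (ℤP.*-comm -1ℤ Sy))))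
  ∇ΣflipColumn : ∇ α (prefixSum (column (t , s))) ≡ -1ℤ
  ∇ΣflipColumn =
    trans (∇-cong α (λ v → trans (prefixSum-cong (column-flip s t) v) (prefixSum-neg (column α) v)))
          (trans (∇-neg α (prefixSum (column α))) (cong -_ (∇-prefixSum-column s t s≢t)))
  ∇flipColumn : ∇ α (column (t , s)) ≡ - ℤ.+ 2
  ∇flipColumn = trans (∇-cong α (column-flip s t)) (trans (∇-neg α (column α)) (cong -_ (∇-column s t s≢t)))
  correctedFormR : correctedForm R x′ y′ ≡ parallelForm d x″ y″ + x 1 * (Sy * -1ℤ) + y 1 * (Sx * -1ℤ - Sx * - ℤ.+ 2)
  correctedFormR =
    trans (correctedForm-∷ t s (parallelClass α d) x′ y′ t≢s)
          (cong₂ _+_ (cong₂ _+_ (correctedForm-parallel s t d x″ y″ s≢t) (cong (x 1 *_) ∇ΣflowPd))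
                     (cong (y 1 *_) (cong₂ _-_ (trans (pairing-parallel s t d x″ (prefixSum (column (t , s))))
                                                      (cong (Sx *_) ∇ΣflipColumn))
                                               (trans (pairing-parallel s t d x″ (column (t , s)))
                                                      (cong (Sx *_) ∇flipColumn)))))
  flowR : flow R y′ ≗ (λ v → (Sy - y 1) * column α v)
  flowR v = trans (cong₂ (λ c f → y 1 * c + f) (column-flip s t v) (flow-parallel s t d y″ v))
                  (factor (y 1) Sy (column α v))
    where
    factor : ∀ a b c → a * - c + b * c ≡ (b - a) * c
    factor = solve-∀
  ∇ΣflowR : ∇ α (prefixSum (flow R y′)) ≡ Sy - y 1
  ∇ΣflowR = trans (∇-cong α (prefixSum-cong flowR)) (∇-prefixSum-*column s t (Sy - y 1) s≢t)
  pairingR : ∀ h → pairing R x′ h ≡ x 1 * - ∇ α h + Sx * ∇ α h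
  pairingR h = cong₂ _+_ (cong (x 1 *_) (∇-flip s t h)) (pairing-parallel s t d x″ h)
  rearrange : ∀ e x₀ x₁ y₀ y₁ sx sy →
    e + x₁ * (sy * -1ℤ) + y₁ * (sx * -1ℤ - sx * - ℤ.+ 2) + x₀ * (sy - y₁)
      + y₀ * ((x₁ * - 1ℤ + sx * 1ℤ) - (x₁ * - ℤ.+ 2 + sx * ℤ.+ 2))
    ≡ e - x₁ * sy + y₁ * sx + x₀ * (sy - y₁) + y₀ * (x₁ - sx)
  rearrange = solve-∀

-- The form on the parallel class

netMultiplicity-cong : ∀ d {x x′} → x ≗ x′ → netMultiplicity d x ≡ netMultiplicity d x′
netMultiplicity-cong zero    x≗x′ = x≗x′ 0
netMultiplicity-cong (suc d) x≗x′ =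
  cong₂ _+_ (cong₂ _-_ (x≗x′ 0) (x≗x′ 1)) (netMultiplicity-cong d (x≗x′ ∘ suc ∘ suc))

parallelForm-cong : ∀ d {x x′ y y′} → x ≗ x′ → y ≗ y′ → parallelForm d x y ≡ parallelForm d x′ y′
parallelForm-cong zero    x≗x′ y≗y′ = refl
parallelForm-cong (suc d) x≗x′ y≗y′ =
  cong₂ _+_ (cong₂ _+_ (cong₂ _+_ (cong₂ _-_ (parallelForm-cong d x≗x″ y≗y″) (cong₂ _*_ (x≗x′ 1) Sy))
                                  (cong₂ _*_ (y≗y′ 1) Sx))
                       (cong₂ _*_ (x≗x′ 0) (cong₂ _-_ Sy (y≗y′ 1))))
            (cong₂ _*_ (y≗y′ 0) (cong₂ _-_ (x≗x′ 1) Sx))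
  where
  x≗x″ = x≗x′ ∘ suc ∘ suc
  y≗y″ = y≗y′ ∘ suc ∘ suc
  Sx = netMultiplicity-cong d x≗x″
  Sy = netMultiplicity-cong d y≗y″

netMultiplicity-+const : ∀ d x k → netMultiplicity d (λ i → x i + k) ≡ netMultiplicity d x + k
netMultiplicity-+const zero    x k = refl
netMultiplicity-+const (suc d) x k =
  trans (cong (x 0 + k - (x 1 + k) +_) (netMultiplicity-+const d (x ∘ suc ∘ suc) k))
        (cancel (x 0) (x 1) (netMultiplicity d (x ∘ suc ∘ suc)) k)
  where
  cancel : ∀ a b s k → a + k - (b + k) + (s + k) ≡ a - b + s + k
  cancel = solve-∀

netMultiplicity-const : ∀ d k → netMultiplicity d (const k) ≡ k
netMultiplicity-const zero    k = refl
netMultiplicity-const (suc d) k = trans (cong (k - k +_) (netMultiplicity-const d k)) (cancel k)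
  where
  cancel : ∀ k → k - k + k ≡ k
  cancel = solve-∀

parallelForm-+constˡ : ∀ d x y k → parallelForm d (λ i → x i + k) y ≡ parallelForm d x y
parallelForm-+constˡ zero    x y k = refl
parallelForm-+constˡ (suc d) x y k =
  trans (cong₂ (λ p s → p - (x 1 + k) * Sy + y 1 * s + (x 0 + k) * (Sy - y 1) + y 0 * ((x 1 + k) - s))
               (parallelForm-+constˡ d (x ∘ suc ∘ suc) (y ∘ suc ∘ suc) k)
               (netMultiplicity-+const d (x ∘ suc ∘ suc) k))
        (cancel (parallelForm d (x ∘ suc ∘ suc) (y ∘ suc ∘ suc)) (x 0) (x 1) (y 0) (y 1)
                (netMultiplicity d (x ∘ suc ∘ suc)) Sy k)
  where
  Sy = netMultiplicity d (y ∘ suc ∘ suc)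
  cancel : ∀ p x₀ x₁ y₀ y₁ sx sy k →
    p - (x₁ + k) * sy + y₁ * (sx + k) + (x₀ + k) * (sy - y₁) + y₀ * ((x₁ + k) - (sx + k))
    ≡ p - x₁ * sy + y₁ * sx + x₀ * (sy - y₁) + y₀ * (x₁ - sx)
  cancel = solve-∀

parallelForm-constˡ : ∀ d k y → parallelForm d (const k) y ≡ 0ℤ
parallelForm-constˡ zero    k y = refl
parallelForm-constˡ (suc d) k y =
  trans (cong₂ (λ p s → p - k * Sy + y 1 * s + k * (Sy - y 1) + y 0 * (k - s))
               (parallelForm-constˡ d k (y ∘ suc ∘ suc)) (netMultiplicity-const d k))
        (cancel k (y 0) (y 1) Sy)
  where
  Sy = netMultiplicity d (y ∘ suc ∘ suc)
  cancel : ∀ k y₀ y₁ sy → 0ℤ - k * sy + y₁ * k + k * (sy - y₁) + y₀ * (k - k) ≡ 0ℤ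
  cancel = solve-∀

double : ℕ → ℕ
double zero    = zero
double (suc d) = suc (suc (double d))

double≡2* : ∀ d → double d ≡ 2 ℕ.* d
double≡2* zero    = refl
double≡2* (suc d) = trans (cong (suc ∘ suc) (double≡2* d)) (sym (ℕP.*-suc 2 d))

leftFactor rightFactor : (d : ℕ) → Fin (double d) → Seq → ℤ
leftFactor (suc d) Fin.zero                x = x 1 - x 0
leftFactor (suc d) (Fin.suc Fin.zero)      x = netMultiplicity d (x ∘ suc ∘ suc) - x 0
leftFactor (suc d) (Fin.suc (Fin.suc k))   x = leftFactor d k (λ i → x (suc (suc i)) - x 0)
rightFactor (suc d) Fin.zero               y = y 0 - netMultiplicity d (y ∘ suc ∘ suc)
rightFactor (suc d) (Fin.suc Fin.zero)     y = y 1 - y 0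
rightFactor (suc d) (Fin.suc (Fin.suc k))  y = rightFactor d k (y ∘ suc ∘ suc)

-- After normalising x 0 to 0 (parallelForm-+constˡ), the recursion for parallelForm (suc d)
-- adds exactly two rank-one terms.
parallelForm-factorisation : ∀ d x y → parallelForm d x y ≡ ∑ (λ k → leftFactor d k x * rightFactor d k y)
parallelForm-factorisation zero    x y = refl
parallelForm-factorisation (suc d) x y = begin
  parallelForm (suc d) x y
    ≡⟨ sym (parallelForm-+constˡ (suc d) x y (- x 0)) ⟩
  parallelForm (suc d) x̃ y
    ≡⟨⟩
  parallelForm d x̃″ y″ - (x 1 - x 0) * Sy + y 1 * netMultiplicity d x̃″ + (x 0 - x 0) * (Sy - y 1)
    + y 0 * ((x 1 - x 0) - netMultiplicity d x̃″)
    ≡⟨ cong₂ (λ p s → p - (x 1 - x 0) * Sy + y 1 * s + (x 0 - x 0) * (Sy - y 1) + y 0 * ((x 1 - x 0) - s))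
             (parallelForm-factorisation d x̃″ y″) (netMultiplicity-+const d x″ (- x 0)) ⟩
  rest - (x 1 - x 0) * Sy + y 1 * (Sx - x 0) + (x 0 - x 0) * (Sy - y 1) + y 0 * ((x 1 - x 0) - (Sx - x 0))
    ≡⟨ rearrange rest (x 0) (x 1) (y 0) (y 1) Sx Sy ⟩
  (x 1 - x 0) * (y 0 - Sy) + ((Sx - x 0) * (y 1 - y 0) + rest) ∎
  where
  open ≡-Reasoning
  x̃ x″ x̃″ y″ : Seq
  x̃ i = x i + - x 0
  x″ = x ∘ suc ∘ suc
  x̃″ i = x (suc (suc i)) - x 0
  y″ = y ∘ suc ∘ suc
  Sx Sy rest : ℤ
  Sx = netMultiplicity d x″
  Sy = netMultiplicity d y″
  rest = ∑ (λ k → leftFactor d k x̃″ * rightFactor d k y″)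
  rearrange : ∀ r x₀ x₁ y₀ y₁ sx sy →
    r - (x₁ - x₀) * sy + y₁ * (sx - x₀) + (x₀ - x₀) * (sy - y₁) + y₀ * ((x₁ - x₀) - (sx - x₀))
    ≡ (x₁ - x₀) * (y₀ - sy) + ((sx - x₀) * (y₁ - y₀) + r)
  rearrange = solve-∀

ones₀₁ onesFrom₁ : Seq
ones₀₁ zero          = 1ℤ
ones₀₁ (suc zero)    = 1ℤ
ones₀₁ (suc (suc i)) = 0ℤ
onesFrom₁ zero    = 0ℤ
onesFrom₁ (suc i) = 1ℤ

parallelForm-ones₀₁ˡ : ∀ d y → parallelForm (suc d) ones₀₁ y ≡ y 0 - y 1
parallelForm-ones₀₁ˡ d y =
  trans (cong₂ (λ p s → p - 1ℤ * Sy + y 1 * s + 1ℤ * (Sy - y 1) + y 0 * (1ℤ - s))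
               (parallelForm-constˡ d 0ℤ (y ∘ suc ∘ suc)) (netMultiplicity-const d 0ℤ))
        (simplify (y 0) (y 1) Sy)
  where
  Sy = netMultiplicity d (y ∘ suc ∘ suc)
  simplify : ∀ y₀ y₁ sy → 0ℤ - 1ℤ * sy + y₁ * 0ℤ + 1ℤ * (sy - y₁) + y₀ * (1ℤ - 0ℤ) ≡ y₀ - y₁
  simplify = solve-∀

parallelForm-onesFrom₁ˡ : ∀ d y → parallelForm (suc d) onesFrom₁ y ≡ y 1 - netMultiplicity d (y ∘ suc ∘ suc)
parallelForm-onesFrom₁ˡ d y =
  trans (cong₂ (λ p s → p - 1ℤ * Sy + y 1 * s + 0ℤ * (Sy - y 1) + y 0 * (1ℤ - s))
               (parallelForm-constˡ d 1ℤ (y ∘ suc ∘ suc)) (netMultiplicity-const d 1ℤ))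
        (simplify (y 0) (y 1) Sy)
  where
  Sy = netMultiplicity d (y ∘ suc ∘ suc)
  simplify : ∀ y₀ y₁ sy → 0ℤ - 1ℤ * sy + y₁ * 1ℤ + 0ℤ * (sy - y₁) + y₀ * (1ℤ - 1ℤ) ≡ y₁ - sy
  simplify = solve-∀

parallelForm-prependZeros₂ : ∀ d x y → parallelForm (suc d) (prependZeros 2 x) (prependZeros 2 y) ≡ parallelForm d x y
parallelForm-prependZeros₂ d x y = vanish (parallelForm d x y) (netMultiplicity d x) (netMultiplicity d y)
  where
  vanish : ∀ p sx sy → p - 0ℤ * sy + 0ℤ * sx + 0ℤ * (sy - 0ℤ) + 0ℤ * (0ℤ - sx) ≡ p
  vanish = solve-∀

-- Radical vectors realising a nonsingular 2d × 2d minor: the Gram matrix of the pairs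
-- (ones₀₁ , onesFrom₁) is [[-1 , 0] , [* , 1]], and padding pushes later pairs past them,
-- so the whole matrix is block lower triangular.
witnessˡ witnessʳ : (d : ℕ) → Fin (double d) → Seq
witnessˡ (suc d) Fin.zero              = ones₀₁
witnessˡ (suc d) (Fin.suc Fin.zero)    = onesFrom₁
witnessˡ (suc d) (Fin.suc (Fin.suc i)) = prependZeros 2 (witnessˡ d i)
witnessʳ (suc d) Fin.zero              = onesFrom₁
witnessʳ (suc d) (Fin.suc Fin.zero)    = ones₀₁
witnessʳ (suc d) (Fin.suc (Fin.suc i)) = prependZeros 2 (witnessʳ d i)

netMultiplicity-ones₀₁ : ∀ d → netMultiplicity (suc d) ones₀₁ ≡ 0ℤ
netMultiplicity-ones₀₁ d = cong (1ℤ - 1ℤ +_) (netMultiplicity-const d 0ℤ)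

netMultiplicity-onesFrom₁ : ∀ d → netMultiplicity (suc d) onesFrom₁ ≡ 0ℤ
netMultiplicity-onesFrom₁ d = cong (0ℤ - 1ℤ +_) (netMultiplicity-const d 1ℤ)

netMultiplicity-witnessˡ : ∀ d i → netMultiplicity d (witnessˡ d i) ≡ 0ℤ
netMultiplicity-witnessˡ (suc d) Fin.zero              = netMultiplicity-ones₀₁ d
netMultiplicity-witnessˡ (suc d) (Fin.suc Fin.zero)    = netMultiplicity-onesFrom₁ d
netMultiplicity-witnessˡ (suc d) (Fin.suc (Fin.suc i)) = trans (ℤP.+-identityˡ _) (netMultiplicity-witnessˡ d i)

netMultiplicity-witnessʳ : ∀ d i → netMultiplicity d (witnessʳ d i) ≡ 0ℤ
netMultiplicity-witnessʳ (suc d) Fin.zero              = netMultiplicity-onesFrom₁ d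
netMultiplicity-witnessʳ (suc d) (Fin.suc Fin.zero)    = netMultiplicity-ones₀₁ d
netMultiplicity-witnessʳ (suc d) (Fin.suc (Fin.suc i)) = trans (ℤP.+-identityˡ _) (netMultiplicity-witnessʳ d i)

det-witness : ∀ d → det (double d) (λ i j → parallelForm d (witnessˡ d i) (witnessʳ d j)) ≡ -1ℤ ℤ.^ d
det-witness zero    = refl
det-witness (suc d) =
  trans (det-twoPivots (double d) M row₀ row₁)
        (cong₂ (λ a b → a * b) (cong₂ _*_ M₀₀ M₁₁)
               (trans (det-cong (double d) (λ i j → parallelForm-prependZeros₂ d (witnessˡ d i) (witnessʳ d j)))
                      (det-witness d)))
  where
  M : Mat (double (suc d))
  M i j = parallelForm (suc d) (witnessˡ (suc d) i) (witnessʳ (suc d) j)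
  M₀₀ : M Fin.zero Fin.zero ≡ -1ℤ
  M₀₀ = parallelForm-ones₀₁ˡ d onesFrom₁
  M₁₁ : M (Fin.suc Fin.zero) (Fin.suc Fin.zero) ≡ 1ℤ
  M₁₁ = trans (parallelForm-onesFrom₁ˡ d ones₀₁) (cong (λ s → 1ℤ - s) (netMultiplicity-const d 0ℤ))
  row₀ : ∀ j → M Fin.zero (Fin.suc j) ≡ 0ℤ
  row₀ Fin.zero    = parallelForm-ones₀₁ˡ d ones₀₁
  row₀ (Fin.suc j) = parallelForm-ones₀₁ˡ d (prependZeros 2 (witnessʳ d j))
  row₁ : ∀ j → M (Fin.suc Fin.zero) (Fin.suc (Fin.suc j)) ≡ 0ℤ
  row₁ j = trans (parallelForm-onesFrom₁ˡ d (prependZeros 2 (witnessʳ d j)))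
                 (cong (λ s → 0ℤ - s) (netMultiplicity-witnessʳ d j))

-- Quiver forms of lists of arrows

toSeq : ∀ {n} → (Fin n → ℤ) → Seq
toSeq {zero}  x i       = 0ℤ
toSeq {suc n} x zero    = x Fin.zero
toSeq {suc n} x (suc i) = toSeq (x ∘ Fin.suc) i

∑-incidence* : ∀ A (x : Fin (length A) → ℤ) v → ∑ (λ a → column (lookup A a) v * x a) ≡ flow A (toSeq x) v
∑-incidence* []      x v = refl
∑-incidence* (a ∷ A) x v = cong₂ _+_ (ℤP.*-comm _ (x Fin.zero)) (∑-incidence* A (x ∘ Fin.suc) v)

∑-∇column* : ∀ a A (y : Fin (length A) → ℤ) → ∑ (λ j → ∇ a (column (lookup A j)) * y j) ≡ ∇ a (flow A (toSeq y))
∑-∇column* (s , t) A y =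
  trans (∑-cong (λ j → ℤP.*-distribʳ-+ (y j) (column (lookup A j) s) (- column (lookup A j) t)))
        (trans (∑-+ (λ j → column (lookup A j) s * y j) (λ j → - column (lookup A j) t * y j))
               (cong₂ _+_ (∑-incidence* A y s)
                          (trans (∑-cong (λ j → sym (ℤP.neg-distribˡ-* (column (lookup A j) t) (y j))))
                                 (trans (∑-neg (λ j → column (lookup A j) t * y j)) (cong -_ (∑-incidence* A y t))))))

gram upperGram : (A : List Arrow) → Fin (length A) → Fin (length A) → ℤ
gram A a b = ∇ (lookup A a) (column (lookup A b))
upperGram A a b = if does (a Fin.<? b) then gram A a b else (if does (a Fin.≟ b) then 1ℤ else 0ℤ)

∑∑-upperGram : ∀ A (x y : Fin (length A) → ℤ) →
  ∑ (λ i → ∑ (λ j → x i * upperGram A i j * y j)) ≡ upperForm A (toSeq x) (toSeq y)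
∑∑-upperGram []      x y = refl
∑∑-upperGram (a ∷ A) x y = cong₂ _+_ firstRow otherRows
  where
  x′ y′ : Fin (length A) → ℤ
  x′ = x ∘ Fin.suc
  y′ = y ∘ Fin.suc
  firstRow : x Fin.zero * 1ℤ * y Fin.zero + ∑ (λ j → x Fin.zero * ∇ a (column (lookup A j)) * y′ j)
             ≡ x Fin.zero * y Fin.zero + x Fin.zero * ∇ a (flow A (toSeq y′))
  firstRow =
    cong₂ _+_ (cong (_* y Fin.zero) (ℤP.*-identityʳ (x Fin.zero)))
              (trans (∑-cong (λ j → ℤP.*-assoc (x Fin.zero) (∇ a (column (lookup A j))) (y′ j)))
                     (trans (∑-*ˡ (x Fin.zero) (λ j → ∇ a (column (lookup A j)) * y′ j))
                            (cong (x Fin.zero *_) (∑-∇column* a A y′))))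
  otherRows : ∑ (λ i → x′ i * 0ℤ * y Fin.zero + ∑ (λ j → x′ i * upperGram A i j * y′ j))
              ≡ upperForm A (toSeq x′) (toSeq y′)
  otherRows =
    trans (∑-cong (λ i → trans (cong (_+ ∑ (λ j → x′ i * upperGram A i j * y′ j)) (vanish (x′ i) (y Fin.zero)))
                               (ℤP.+-identityˡ _)))
          (∑∑-upperGram A x′ y′)
    where
    vanish : ∀ a b → a * 0ℤ * b ≡ 0ℤ
    vanish = solve-∀

square-nonNeg : ∀ z → 0ℤ ℤ.≤ z * z
square-nonNeg (ℤ.+ n)    = subst (0ℤ ℤ.≤_) (ℤP.pos-* n n) (ℤ.+≤+ z≤n)
square-nonNeg ℤ.-[1+ n ] = subst (0ℤ ℤ.≤_) (sym (negSquare (ℤ.+ suc n))) (square-nonNeg (ℤ.+ suc n))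
  where
  negSquare : ∀ a → - a * - a ≡ a * a
  negSquare = solve-∀

∑-squares-nonNeg : ∀ {n} (f : Fin n → ℤ) → 0ℤ ℤ.≤ ∑ (λ i → f i * f i)
∑-squares-nonNeg {zero}  f = ℤP.≤-refl
∑-squares-nonNeg {suc n} f = ℤP.+-mono-≤ (square-nonNeg (f Fin.zero)) (∑-squares-nonNeg (f ∘ Fin.suc))

half-double : ∀ z → 0ℤ ℤ.≤ z + z → ℤ.+ (ℤ.∣ z + z ∣ / 2) ≡ z
half-double (ℤ.+ n) _ = cong ℤ.+_ (trans (cong (_/ 2) (trans (cong (n ℕ.+_) (sym (ℕP.+-identityʳ n))) (ℕP.*-comm 2 n)))
                                        (m*n/n≡m n 2))
half-double ℤ.-[1+ n ] ()

ValidArrows : ℕ → List Arrow → Set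
ValidArrows m = All (λ a → IsVertex m (proj₁ a) × IsVertex m (proj₂ a) × proj₁ a ≢ proj₂ a)

ValidArrows⇒AllVertices : ∀ {m A} → ValidArrows m A → AllVertices (IsVertex m) A
ValidArrows⇒AllVertices = All.map (λ (s , t , _) → s , t)

module QuiverForm (m : ℕ) (A : List Arrow) (valid : ValidArrows m A) where

  q : Vecℤ (length A) → ℤ
  q = qQ (quiverFromList m A)

  flowOf : Vecℤ (length A) → ℕ → ℤ
  flowOf x = flow A (toSeq x)

  private
    validAt : ∀ a → IsVertex m (proj₁ (lookup A a)) × IsVertex m (proj₂ (lookup A a))
                    × proj₁ (lookup A a) ≢ proj₂ (lookup A a)
    validAt a = All.lookup valid (∈-lookup a)

    vertex : Fin m → ℕ
    vertex i = suc (toℕ i)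

    ∑-column*ᵃ : ∀ a h → ∑ {m} (λ i → column (lookup A a) (vertex i) * h (vertex i)) ≡ ∇ (lookup A a) h
    ∑-column*ᵃ a h = ∑-column* m (lookup A a) h (proj₁ (validAt a)) (proj₁ (proj₂ (validAt a)))

    gram-diagonal : ∀ a → ∇ (lookup A a) (column (lookup A a)) ≡ ℤ.+ 2
    gram-diagonal a with lookup A a | validAt a
    ... | (s , t) | (_ , _ , s≢t) = ∇-column s t s≢t

    gram-sym : ∀ a b → ∇ (lookup A b) (column (lookup A a)) ≡ gram A a b
    gram-sym a b =
      trans (sym (∑-column*ᵃ b (column (lookup A a))))
            (trans (∑-cong {m} (λ i → ℤP.*-comm (column (lookup A b) (vertex i)) (column (lookup A a) (vertex i))))
                   (∑-column*ᵃ a (column (lookup A b))))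

    flowOf-e : ∀ a v → flowOf (e a) v ≡ column (lookup A a) v
    flowOf-e a v = trans (sym (∑-incidence* A (e a) v))
                     (trans (∑-cong (λ k → ℤP.*-comm (column (lookup A k) v) (e a k))) (∑-e* a (λ k → column (lookup A k) v)))

    flowOf-e⊕e : ∀ a b v → flowOf (e a ⊕ e b) v ≡ column (lookup A a) v + column (lookup A b) v
    flowOf-e⊕e a b v =
      trans (sym (∑-incidence* A (e a ⊕ e b) v))
            (trans (∑-cong (λ k → trans (ℤP.*-distribˡ-+ (column (lookup A k) v) (e a k) (e b k))
                                        (cong₂ _+_ (ℤP.*-comm (column (lookup A k) v) (e a k))
                                                   (ℤP.*-comm (column (lookup A k) v) (e b k)))))
                   (trans (∑-+ (λ k → e a k * column (lookup A k) v) (λ k → e b k * column (lookup A k) v))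
                          (cong₂ _+_ (∑-e* a (λ k → column (lookup A k) v)) (∑-e* b (λ k → column (lookup A k) v)))))

    q≡ : ∀ x → q x ≡ ℤ.+ (ℤ.∣ ∑ {m} (λ i → flowOf x (vertex i) * flowOf x (vertex i)) ∣ / 2)
    q≡ x = cong (λ z → ℤ.+ (ℤ.∣ z ∣ / 2))
                (∑-cong {m} (λ i → cong₂ _*_ (∑-incidence* A x (vertex i)) (∑-incidence* A x (vertex i))))

  q-e : ∀ a → q (e a) ≡ 1ℤ
  q-e a = trans (q≡ (e a)) (cong (λ z → ℤ.+ (ℤ.∣ z ∣ / 2))
    (trans (∑-cong {m} (λ i → cong₂ _*_ (flowOf-e a (vertex i)) (flowOf-e a (vertex i))))
           (trans (∑-column*ᵃ a (column (lookup A a))) (gram-diagonal a))))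

  q-e⊕e : ∀ a b → q (e a ⊕ e b) ≡ ℤ.+ 2 + gram A a b
  q-e⊕e a b = trans (q≡ (e a ⊕ e b))
    (trans (cong (λ z → ℤ.+ (ℤ.∣ z ∣ / 2)) ∑squares)
           (half-double (ℤ.+ 2 + gram A a b)
                        (subst (0ℤ ℤ.≤_) ∑squares (∑-squares-nonNeg {m} (λ i → flowOf (e a ⊕ e b) (vertex i))))))
    where
    ca cb h : ℕ → ℤ
    ca = column (lookup A a)
    cb = column (lookup A b)
    h v = ca v + cb v
    ∑squares : ∑ {m} (λ i → flowOf (e a ⊕ e b) (vertex i) * flowOf (e a ⊕ e b) (vertex i))
               ≡ (ℤ.+ 2 + gram A a b) + (ℤ.+ 2 + gram A a b)
    ∑squares = begin
      ∑ {m} (λ i → flowOf (e a ⊕ e b) (vertex i) * flowOf (e a ⊕ e b) (vertex i))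
        ≡⟨ ∑-cong {m} (λ i → trans (cong₂ _*_ (flowOf-e⊕e a b (vertex i)) (flowOf-e⊕e a b (vertex i)))
                                   (ℤP.*-distribʳ-+ (h (vertex i)) (ca (vertex i)) (cb (vertex i)))) ⟩
      ∑ {m} (λ i → ca (vertex i) * h (vertex i) + cb (vertex i) * h (vertex i))
        ≡⟨ ∑-+ {m} (λ i → ca (vertex i) * h (vertex i)) (λ i → cb (vertex i) * h (vertex i)) ⟩
      ∑ {m} (λ i → ca (vertex i) * h (vertex i)) + ∑ {m} (λ i → cb (vertex i) * h (vertex i))
        ≡⟨ cong₂ _+_ (∑-column*ᵃ a h) (∑-column*ᵃ b h) ⟩
      ∇ (lookup A a) h + ∇ (lookup A b) h
        ≡⟨ cong₂ _+_ (∇-+ (lookup A a) ca cb) (∇-+ (lookup A b) ca cb) ⟩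
      (∇ (lookup A a) ca + gram A a b) + (∇ (lookup A b) ca + ∇ (lookup A b) cb)
        ≡⟨ cong₂ (λ p r → (p + gram A a b) + r) (gram-diagonal a) (cong₂ _+_ (gram-sym a b) (gram-diagonal b)) ⟩
      (ℤ.+ 2 + gram A a b) + (gram A a b + ℤ.+ 2)
        ≡⟨ cong ((ℤ.+ 2 + gram A a b) +_) (ℤP.+-comm (gram A a b) (ℤ.+ 2)) ⟩
      (ℤ.+ 2 + gram A a b) + (ℤ.+ 2 + gram A a b) ∎
      where open ≡-Reasoning

  G≡gram : ∀ a b → G q a b ≡ gram A a b
  G≡gram a b =
    trans (cong₂ (λ p r → p - r - q (e b)) (q-e⊕e a b) (q-e a))
          (trans (cong (λ r → ℤ.+ 2 + gram A a b - 1ℤ - r) (q-e b)) (cancel (gram A a b)))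
    where
    cancel : ∀ g → ℤ.+ 2 + g - 1ℤ - 1ℤ ≡ g
    cancel = solve-∀

  Ǧform≡upperForm : ∀ x y → Ǧform q x y ≡ upperForm A (toSeq x) (toSeq y)
  Ǧform≡upperForm x y =
    trans (∑-cong (λ i → ∑-cong (λ j → cong (λ z → x i * z * y j) (Ǧ≡upperGram i j)))) (∑∑-upperGram A x y)
    where
    Ǧ≡upperGram : ∀ i j → Ǧ q i j ≡ upperGram A i j
    Ǧ≡upperGram i j = cong₂ (λ g z → if does (i Fin.<? j) then g else (if does (i Fin.≟ j) then z else 0ℤ))
                            (G≡gram i j) (q-e i)

  ∑-G* : ∀ x a → ∑ (λ j → G q a j * x j) ≡ ∇ (lookup A a) (flowOf x)
  ∑-G* x a = trans (∑-cong (λ j → cong (_* x j) (G≡gram a j))) (∑-∇column* (lookup A a) A x)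

flow-cong-prefix : ∀ A {x x′} → (∀ i → i < length A → x i ≡ x′ i) → ∀ v → flow A x v ≡ flow A x′ v
flow-cong-prefix []      x≡x′ v = refl
flow-cong-prefix (a ∷ A) x≡x′ v =
  cong₂ _+_ (cong (_* column a v) (x≡x′ 0 (s≤s z≤n))) (flow-cong-prefix A (λ i i< → x≡x′ (suc i) (s≤s i<)) v)

upperForm-cong-prefix : ∀ A {x x′ y y′} →
  (∀ i → i < length A → x i ≡ x′ i) → (∀ i → i < length A → y i ≡ y′ i) →
  upperForm A x y ≡ upperForm A x′ y′
upperForm-cong-prefix []      x≡x′ y≡y′ = refl
upperForm-cong-prefix (a ∷ A) x≡x′ y≡y′ =
  cong₂ _+_ (cong₂ _+_ (cong₂ _*_ (x≡x′ 0 (s≤s z≤n)) (y≡y′ 0 (s≤s z≤n)))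
                       (cong₂ _*_ (x≡x′ 0 (s≤s z≤n)) (∇-cong a (flow-cong-prefix A (λ i i< → y≡y′ (suc i) (s≤s i<))))))
            (upperForm-cong-prefix A (λ i i< → x≡x′ (suc i) (s≤s i<)) (λ i i< → y≡y′ (suc i) (s≤s i<)))

flow-++-prependZeros : ∀ A B k x v → length A ≡ k → flow (A ++ B) (prependZeros k x) v ≡ flow B x v
flow-++-prependZeros []      B zero    x v refl = refl
flow-++-prependZeros (a ∷ A) B (suc k) x v |A|≡k =
  trans (cong (_+ flow (A ++ B) (prependZeros k x) v) (ℤP.*-zeroˡ (column a v)))
        (trans (ℤP.+-identityˡ _) (flow-++-prependZeros A B k x v (ℕP.suc-injective |A|≡k)))

toSeq-toℕ : ∀ n (f : Seq) i → i < n → toSeq {n} (f ∘ toℕ) i ≡ f i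
toSeq-toℕ (suc n) f zero    _       = refl
toSeq-toℕ (suc n) f (suc i) (s≤s i<n) = toSeq-toℕ n (f ∘ suc) i i<n

∑-const : ∀ k (a : ℤ) → ∑ {k} (const a) ≡ ℤ.+ k * a
∑-const zero    a = sym (ℤP.*-zeroˡ a)
∑-const (suc k) a =
  trans (cong (a +_) (∑-const k a))
        (trans (cong (_+ ℤ.+ k * a) (sym (ℤP.*-identityˡ a))) (sym (ℤP.*-distribʳ-+ a 1ℤ (ℤ.+ k))))

ConsecutivelyConnected : ℕ → List Arrow → Set
ConsecutivelyConnected m A =
  ∀ f → All (λ a → ∇ a f ≡ 0ℤ) A → ∀ u → 1 ≤ u → u < m → f u ≡ f (suc u)

constant-∑≡0⇒≡0 : ∀ m (f : ℕ → ℤ) → 1 ≤ m → (∀ u → 1 ≤ u → u < m → f u ≡ f (suc u)) →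
  ∑ {m} (λ i → f (suc (toℕ i)) * 1ℤ) ≡ 0ℤ → ∀ u → 1 ≤ u → u ≤ m → f u ≡ 0ℤ
constant-∑≡0⇒≡0 m f 1≤m step ∑≡0 u 1≤u u≤m = trans (f≡f1 u 1≤u u≤m) f1≡0
  where
  f≡f1 : ∀ u → 1 ≤ u → u ≤ m → f u ≡ f 1
  f≡f1 (suc zero)    _ _     = refl
  f≡f1 (suc (suc u)) _ 2+u≤m = trans (sym (step (suc u) (s≤s z≤n) 2+u≤m)) (f≡f1 (suc u) (s≤s z≤n) (ℕP.<⇒≤ 2+u≤m))
  m*f1≡0 : ℤ.+ m * f 1 ≡ 0ℤ
  m*f1≡0 = trans (sym (∑-const m (f 1)))
                 (trans (sym (∑-cong (λ i → trans (ℤP.*-identityʳ _) (f≡f1 (suc (toℕ i)) (s≤s z≤n) (toℕ<n i))))) ∑≡0)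
  f1≡0 : f 1 ≡ 0ℤ
  f1≡0 with ℤP.i*j≡0⇒i≡0∨j≡0 (ℤ.+ m) m*f1≡0
  ... | inj₁ m≡0 = ⊥-elim (ℕP.<-irrefl refl (subst (1 ≤_) (ℤP.+-injective m≡0) 1≤m))
  ... | inj₂ f1≡0 = f1≡0

module StandardShape (m r c : ℕ) (w : ℕ → ℕ) (s t d : ℕ)
  (valid : ValidArrows m (path 1 r ++ (chain w c ++ parallelClass (s , t) d)))
  (decreasing : StrictlyDecreasing w c)
  (below : AllVertices (_≤ w c) (parallelClass (s , t) d))
  (connected : ConsecutivelyConnected m (path 1 r ++ (chain w c ++ parallelClass (s , t) d)))
  where

  arrows : List Arrow
  arrows = path 1 r ++ (chain w c ++ parallelClass (s , t) d)

  open QuiverForm m arrows valid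

  private
    vertices : AllVertices (IsVertex m) arrows
    vertices = ValidArrows⇒AllVertices valid

    validα : IsVertex m s × IsVertex m t × s ≢ t
    validα with ++⁻ʳ (chain w c) (++⁻ʳ (path 1 r) valid)
    ... | αvalid ∷ _ = αvalid

    1≤m : 1 ≤ m
    1≤m = ℕP.≤-trans (proj₁ (proj₁ validα)) (proj₂ (proj₁ validα))

    parallelPart : Seq → Seq
    parallelPart X = shift c (shift r X)

  upperForm≡parallelForm : ∀ X Y → (∀ v → flow arrows X v ≡ 0ℤ) → (∀ v → flow arrows Y v ≡ 0ℤ) →
    upperForm arrows X Y ≡ parallelForm d (parallelPart X) (parallelPart Y)
  upperForm≡parallelForm X Y flowX≡0 flowY≡0 =
    trans (upperForm-afterPath m r (chain w c ++ parallelClass (s , t) d) X Y vertices flowX≡0 flowY≡0)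
          (trans (correctedForm-chain c w (parallelClass (s , t) d) (shift r X) (shift r Y) decreasing below)
                 (correctedForm-parallel s t d (parallelPart X) (parallelPart Y) (proj₂ (proj₂ validα))))

  -- The flow of a radical vector is a potential constant along all arrows whose sum over
  -- the vertices is ⟨x , Iᵀ 1⟩ = 0.
  rad⇒flow≡0 : ∀ x → rad q x → ∀ v → flowOf x v ≡ 0ℤ
  rad⇒flow≡0 x radx v with 1 ℕ.≤? v | v ℕ.≤? m
  ... | yes 1≤v | yes v≤m =
    constant-∑≡0⇒≡0 m (flowOf x) 1≤m (connected (flowOf x) ∇flow≡0) ∑flow≡0 v 1≤v v≤m
    where
    ∇flow≡0 : All (λ a → ∇ a (flowOf x) ≡ 0ℤ) arrows
    ∇flow≡0 = All.tabulate λ a∈ →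
      subst (λ b → ∇ b (flowOf x) ≡ 0ℤ) (sym (lookup-index a∈))
            (trans (sym (∑-G* x (Any.index a∈))) (radx (Any.index a∈)))
    ∑flow≡0 : ∑ {m} (λ i → flowOf x (suc (toℕ i)) * 1ℤ) ≡ 0ℤ
    ∑flow≡0 = trans (sym (pairing-transpose m arrows (toSeq x) (const 1ℤ) vertices))
                    (pairing-const arrows (toSeq x) 1ℤ)
  ... | no 1≰v | _      = flow-outside arrows (toSeq x) v (AllVertices-map (λ { (1≤u , _) refl → 1≰v 1≤u }) vertices)
  ... | _      | no v≰m = flow-outside arrows (toSeq x) v (AllVertices-map (λ { (_ , u≤m) refl → v≰m u≤m }) vertices)

  flow≡0⇒rad : ∀ x → (∀ v → flowOf x v ≡ 0ℤ) → rad q x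
  flow≡0⇒rad x flowOf≡0 a = trans (∑-G* x a) (cong₂ _-_ (flowOf≡0 _) (flowOf≡0 _))

  Ǧform-rad : ∀ x y → rad q x → rad q y → Ǧform q x y ≡ parallelForm d (parallelPart (toSeq x)) (parallelPart (toSeq y))
  Ǧform-rad x y radx rady =
    trans (Ǧform≡upperForm x y) (upperForm≡parallelForm (toSeq x) (toSeq y) (rad⇒flow≡0 x radx) (rad⇒flow≡0 y rady))

  rank-upper : (xs ys : Fin (suc (2 ℕ.* d)) → Vecℤ (length arrows)) → (∀ i → rad q (xs i)) → (∀ i → rad q (ys i)) →
    det (suc (2 ℕ.* d)) (λ i j → Ǧform q (xs i) (ys j)) ≡ 0ℤ
  rank-upper xs ys radxs radys =
    det-lowRank (suc (2 ℕ.* d)) (double d) (s≤s (ℕP.≤-reflexive (double≡2* d)))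
      (λ i k → leftFactor d k (parallelPart (toSeq (xs i)))) (λ k j → rightFactor d k (parallelPart (toSeq (ys j)))) _
      (λ i j → trans (Ǧform-rad (xs i) (ys j) (radxs i) (radys j)) (parallelForm-factorisation d _ _))

  private
    embedSeq : Seq → Seq
    embedSeq ξ = prependZeros r (prependZeros c ξ)

    embed : Seq → Vecℤ (length arrows)
    embed ξ k = embedSeq ξ (toℕ k)

    tail-embedSeq : ∀ ξ → parallelPart (embedSeq ξ) ≗ ξ
    tail-embedSeq ξ i = trans (shift-prependZeros r (prependZeros c ξ) (c ℕ.+ i)) (shift-prependZeros c ξ i)

    flow-embedSeq : ∀ ξ → netMultiplicity d ξ ≡ 0ℤ → ∀ v → flow arrows (embedSeq ξ) v ≡ 0ℤ
    flow-embedSeq ξ ξ≡0 v =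
      trans (flow-++-prependZeros (path 1 r) _ r (prependZeros c ξ) v (length-path 1 r))
            (trans (flow-++-prependZeros (chain w c) _ c ξ v (length-chain w c))
                   (trans (flow-parallel s t d ξ v)
                          (trans (cong (_* column (s , t) v) ξ≡0) (ℤP.*-zeroˡ (column (s , t) v)))))

    toSeq-embed : ∀ ξ i → i < length arrows → toSeq (embed ξ) i ≡ embedSeq ξ i
    toSeq-embed ξ = toSeq-toℕ (length arrows) (embedSeq ξ)

    rad-embed : ∀ ξ → netMultiplicity d ξ ≡ 0ℤ → rad q (embed ξ)
    rad-embed ξ ξ≡0 = flow≡0⇒rad (embed ξ) λ v →
      trans (flow-cong-prefix arrows (toSeq-embed ξ) v) (flow-embedSeq ξ ξ≡0 v)

    Ǧform-embed : ∀ ξ η → netMultiplicity d ξ ≡ 0ℤ → netMultiplicity d η ≡ 0ℤ →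
      Ǧform q (embed ξ) (embed η) ≡ parallelForm d ξ η
    Ǧform-embed ξ η ξ≡0 η≡0 =
      trans (Ǧform≡upperForm (embed ξ) (embed η))
            (trans (upperForm-cong-prefix arrows (toSeq-embed ξ) (toSeq-embed η))
                   (trans (upperForm≡parallelForm (embedSeq ξ) (embedSeq η) (flow-embedSeq ξ ξ≡0) (flow-embedSeq η η≡0))
                          (parallelForm-cong d (tail-embedSeq ξ) (tail-embedSeq η))))

  rank-lower : ∀ k → double d ≡ k →
    Σ (Fin k → Vecℤ (length arrows)) λ xs → Σ (Fin k → Vecℤ (length arrows)) λ ys →
      (∀ i → rad q (xs i)) × (∀ i → rad q (ys i)) × det k (λ i j → Ǧform q (xs i) (ys j)) ≢ 0ℤ
  rank-lower .(double d) refl =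
    embed ∘ witnessˡ d , embed ∘ witnessʳ d ,
    (λ i → rad-embed (witnessˡ d i) (netMultiplicity-witnessˡ d i)) ,
    (λ j → rad-embed (witnessʳ d j) (netMultiplicity-witnessʳ d j)) ,
    λ det≡0 → -1^d≢0 (trans (sym det≡±1) det≡0)
    where
    det≡±1 : det (double d) (λ i j → Ǧform q (embed (witnessˡ d i)) (embed (witnessʳ d j))) ≡ -1ℤ ℤ.^ d
    det≡±1 = trans (det-cong (double d) (λ i j → Ǧform-embed (witnessˡ d i) (witnessʳ d j)
                                                    (netMultiplicity-witnessˡ d i) (netMultiplicity-witnessʳ d j)))
                   (det-witness d)
    -1^d≢0 : -1ℤ ℤ.^ d ≢ 0ℤ
    -1^d≢0 -1^d≡0 with ℤP.i^n≡0⇒i≡0 -1ℤ d -1^d≡0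
    ... | ()

  degeneracy : DegreeOfDegeneracy q d
  degeneracy = rank-lower (2 ℕ.* d) (double≡2* d) , rank-upper

-- The standard quivers

applyUpTo≡path : ∀ b k f → (∀ u → f u ≡ (b ℕ.+ u , suc (b ℕ.+ u))) → applyUpTo f k ≡ path b k
applyUpTo≡path b zero    f f≡ = refl
applyUpTo≡path b (suc k) f f≡ =
  cong₂ _∷_ (trans (f≡ 0) (cong (λ z → (z , suc z)) (ℕP.+-identityʳ b)))
            (applyUpTo≡path (suc b) k (f ∘ suc) (λ u → trans (f≡ (suc u)) (cong (λ z → (z , suc z)) (ℕP.+-suc b u))))

iArrows≡path : ∀ m → iArrows m ≡ path 1 (m ∸ 1)
iArrows≡path m =
  trans (ListP.map-applyUpTo id (λ u → (suc u , suc (suc u))) (m ∸ 1)) (applyUpTo≡path 1 (m ∸ 1) _ (λ _ → refl))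

path-snoc : ∀ b k → path b (suc k) ≡ path b k ++ (b ℕ.+ k , suc (b ℕ.+ k)) ∷ []
path-snoc b zero    = cong (λ z → (z , suc z) ∷ []) (sym (ℕP.+-identityʳ b))
path-snoc b (suc k) =
  cong ((b , suc b) ∷_) (trans (path-snoc (suc b) k) (cong (λ z → path (suc b) k ++ (z , suc z) ∷ []) (sym (ℕP.+-suc b k))))

chain≡applyUpTo : ∀ w k → chain w k ≡ applyUpTo (λ u → (w u , w (suc u))) k
chain≡applyUpTo w zero    = refl
chain≡applyUpTo w (suc k) = cong ((w 0 , w 1) ∷_) (chain≡applyUpTo (w ∘ suc) k)

jArrows≡chain : ∀ m π → jArrows m π ≡ chain (v m π) (length π ∸ 1)
jArrows≡chain m π = trans (ListP.map-applyUpTo id (λ u → (v m π u , v m π (suc u))) (length π ∸ 1))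
                          (sym (chain≡applyUpTo (v m π) (length π ∸ 1)))

chain-snoc : ∀ w k → chain w (suc k) ≡ chain w k ++ (w k , w (suc k)) ∷ []
chain-snoc w zero    = refl
chain-snoc w (suc k) = cong ((w 0 , w 1) ∷_) (chain-snoc (w ∘ suc) k)

∸-partialSums-decreasing : ∀ π M → All (1 ≤_) π → sumℕ π ≤ M → ∀ i → i < length π →
  M ∸ sumℕ (take (suc i) π) < M ∸ sumℕ (take i π)
∸-partialSums-decreasing (p ∷ π) M (1≤p ∷ _) ∑≤M zero _ =
  ℕP.∸-monoʳ-< (subst (0 <_) (sym (ℕP.+-identityʳ p)) 1≤p) (ℕP.≤-trans (ℕP.+-monoʳ-≤ p z≤n) ∑≤M)
∸-partialSums-decreasing (p ∷ π) M (_ ∷ positive) ∑≤M (suc i) (s≤s i<ℓ) =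
  subst₂ _<_ (ℕP.∸-+-assoc M p (sumℕ (take (suc i) π))) (ℕP.∸-+-assoc M p (sumℕ (take i π)))
    (∸-partialSums-decreasing π (M ∸ p) positive
      (ℕP.≤-trans (ℕP.≤-reflexive (sym (ℕP.m+n∸m≡n p (sumℕ π)))) (ℕP.∸-monoˡ-≤ p ∑≤M)) i i<ℓ)

parallelClass-vertices : ∀ {P : ℕ → Set} s t d → P s → P t → AllVertices P (parallelClass (s , t) d)
parallelClass-vertices s t d Ps Pt = (Ps , Pt) ∷ kArrows-vertices d
  where
  kArrows-vertices : ∀ d → AllVertices _ (kArrows (s , t) d)
  kArrows-vertices zero    = []
  kArrows-vertices (suc d) = (Pt , Ps) ∷ (Ps , Pt) ∷ kArrows-vertices d

parallelClass-valid : ∀ m s t d → IsVertex m s → IsVertex m t → s ≢ t → ValidArrows m (parallelClass (s , t) d)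
parallelClass-valid m s t d s∈ t∈ s≢t = (s∈ , t∈ , s≢t) ∷ kArrows-valid d
  where
  kArrows-valid : ∀ d → ValidArrows m (kArrows (s , t) d)
  kArrows-valid zero    = []
  kArrows-valid (suc d) = (t∈ , s∈ , s≢t ∘ sym) ∷ (s∈ , t∈ , s≢t) ∷ kArrows-valid d

path-valid : ∀ m b k → 1 ≤ b → b ℕ.+ k ≤ m → ValidArrows m (path b k)
path-valid m b zero    1≤b b+k≤m = []
path-valid m b (suc k) 1≤b b+k≤m =
  ((1≤b , ℕP.≤-trans (ℕP.m≤m+n b k) (ℕP.<⇒≤ 1+b+k≤m)) , (s≤s z≤n , ℕP.≤-trans (s≤s (ℕP.m≤m+n b k)) 1+b+k≤m)
  , (ℕP.1+n≢n ∘ sym))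
  ∷ path-valid m (suc b) k (s≤s z≤n) 1+b+k≤m
  where
  1+b+k≤m : suc (b ℕ.+ k) ≤ m
  1+b+k≤m = subst (_≤ m) (ℕP.+-suc b k) b+k≤m

chain-valid : ∀ m k w → (∀ i → i ≤ k → IsVertex m (w i)) → StrictlyDecreasing w k → ValidArrows m (chain w k)
chain-valid m zero    w w∈ dec = []
chain-valid m (suc k) w w∈ dec =
  (w∈ 0 z≤n , w∈ 1 (s≤s z≤n) , λ w₀≡w₁ → ℕP.<-irrefl (sym w₀≡w₁) (dec 0 (s≤s z≤n)))
  ∷ chain-valid m k (w ∘ suc) (λ i i≤k → w∈ (suc i) (s≤s i≤k)) (StrictlyDecreasing-tail w k dec)

path-constant : ∀ b k f → All (λ a → ∇ a f ≡ 0ℤ) (path b k) → ∀ u → b ≤ u → u < b ℕ.+ k → f u ≡ f (suc u)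
path-constant b zero    f ∇≡0 u b≤u u<b+0 =
  ⊥-elim (ℕP.<-irrefl refl (ℕP.<-≤-trans u<b+0 (subst (_≤ u) (sym (ℕP.+-identityʳ b)) b≤u)))
path-constant b (suc k) f (∇≡0 ∷ ∇s≡0) u b≤u u<b+k with b ℕ.≟ u
... | yes refl = ℤP.i-j≡0⇒i≡j (f b) (f (suc b)) ∇≡0
... | no b≢u   = path-constant (suc b) k f ∇s≡0 u (ℕP.≤∧≢⇒< b≤u b≢u) (subst (u <_) (ℕP.+-suc b k) u<b+k)

iArrows-connected : ∀ m B → 1 ≤ m → ConsecutivelyConnected m (iArrows m ++ B)
iArrows-connected m B 1≤m f ∇≡0 u 1≤u u<m =
  path-constant 1 (m ∸ 1) f
    (++⁻ˡ (path 1 (m ∸ 1)) (subst (All (λ a → ∇ a f ≡ 0ℤ)) (cong (_++ B) (iArrows≡path m)) ∇≡0))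
    u 1≤u (subst (u <_) (sym (ℕP.m+[n∸m]≡n 1≤m)) u<m)

degeneracy-byShape : ∀ m π d r c w s t →
  iArrows m ++ jArrows m π ++ kArrows (αArrow m π) d ≡ path 1 r ++ (chain w c ++ parallelClass (s , t) d) →
  1 ≤ m → ValidArrows m (path 1 r ++ (chain w c ++ parallelClass (s , t) d)) →
  StrictlyDecreasing w c → AllVertices (_≤ w c) (parallelClass (s , t) d) →
  DegreeOfDegeneracy (qQ (stdQuiver m π d)) d
degeneracy-byShape m π d r c w s t arrows≡ 1≤m valid decreasing below =
  subst (λ A → DegreeOfDegeneracy (qQ (quiverFromList m A)) d) (sym arrows≡)
        (StandardShape.degeneracy m r c w s t d valid decreasing below
          (subst (ConsecutivelyConnected m) arrows≡ (iArrows-connected m _ 1≤m)))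

degeneracy-onePart : ∀ k p d → DegreeOfDegeneracy (qQ (stdQuiver (suc (suc k)) (p ∷ []) d)) d
degeneracy-onePart k p d =
  degeneracy-byShape m (p ∷ []) d k 0 (λ _ → m) (suc k) m arrows≡ (s≤s z≤n) valid (λ _ ()) below
  where
  m = suc (suc k)
  K = kArrows (suc k , m) d
  arrows≡ : iArrows m ++ [] ++ K ≡ path 1 k ++ (chain (λ _ → m) 0 ++ parallelClass (suc k , m) d)
  arrows≡ = trans (cong (_++ K) (trans (iArrows≡path m) (path-snoc 1 k))) (ListP.++-assoc (path 1 k) _ K)
  valid : ValidArrows m (path 1 k ++ (chain (λ _ → m) 0 ++ parallelClass (suc k , m) d))
  valid = ++⁺ (path-valid m 1 k (s≤s z≤n) (ℕP.n≤1+n (suc k)))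
              (parallelClass-valid m (suc k) m d (s≤s z≤n , ℕP.n≤1+n (suc k)) (s≤s z≤n , ℕP.≤-refl) (ℕP.1+n≢n ∘ sym))
  below : AllVertices (_≤ m) (parallelClass (suc k , m) d)
  below = parallelClass-vertices (suc k) m d (ℕP.n≤1+n (suc k)) ℕP.≤-refl

degeneracy-severalParts : ∀ m p₁ p₂ π d → 2 ≤ m → IsPartition m (p₁ ∷ p₂ ∷ π) →
  DegreeOfDegeneracy (qQ (stdQuiver m (p₁ ∷ p₂ ∷ π) d)) d
degeneracy-severalParts m p₁ p₂ π d 2≤m (positive , _ , ∑≡m) =
  degeneracy-byShape m (p₁ ∷ p₂ ∷ π) d (m ∸ 1) ℓ vs s t arrows≡ 1≤m valid decreasing below
  where
  ℓ = length π
  vs : ℕ → ℕ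
  vs = v m (p₁ ∷ p₂ ∷ π)
  s t : ℕ
  s = vs ℓ
  t = vs (suc ℓ)
  K = kArrows (s , t) d
  1≤m : 1 ≤ m
  1≤m = ℕP.≤-trans (s≤s z≤n) 2≤m
  arrows≡ : iArrows m ++ jArrows m (p₁ ∷ p₂ ∷ π) ++ K ≡ path 1 (m ∸ 1) ++ (chain vs ℓ ++ parallelClass (s , t) d)
  arrows≡ = cong₂ _++_ (iArrows≡path m)
    (trans (cong (_++ K) (trans (jArrows≡chain m (p₁ ∷ p₂ ∷ π)) (chain-snoc vs ℓ))) (ListP.++-assoc (chain vs ℓ) _ K))
  vs-decreasing : ∀ i → i < suc (suc ℓ) → vs (suc i) < vs i
  vs-decreasing = ∸-partialSums-decreasing (p₁ ∷ p₂ ∷ π) m positive (ℕP.≤-reflexive ∑≡m)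
  vs-vertex : ∀ u → u < suc (suc ℓ) → IsVertex m (vs u)
  vs-vertex u u<ℓ = ℕP.≤-trans (s≤s z≤n) (vs-decreasing u u<ℓ) , ℕP.m∸n≤m m (sumℕ (take u (p₁ ∷ p₂ ∷ π)))
  s≢t : s ≢ t
  s≢t s≡t = ℕP.<-irrefl (sym s≡t) (vs-decreasing ℓ (s≤s (ℕP.n≤1+n ℓ)))
  decreasing : StrictlyDecreasing vs ℓ
  decreasing i i<ℓ = vs-decreasing i (ℕP.m<n⇒m<1+n (ℕP.m<n⇒m<1+n i<ℓ))
  valid : ValidArrows m (path 1 (m ∸ 1) ++ (chain vs ℓ ++ parallelClass (s , t) d))
  valid = ++⁺ (path-valid m 1 (m ∸ 1) (s≤s z≤n) (ℕP.≤-reflexive (ℕP.m+[n∸m]≡n 1≤m)))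
              (++⁺ (chain-valid m ℓ vs (λ i i≤ℓ → vs-vertex i (ℕP.≤-trans (s≤s i≤ℓ) (ℕP.n≤1+n (suc ℓ))))
                                decreasing)
                   (parallelClass-valid m s t d (vs-vertex ℓ (ℕP.n≤1+n (suc ℓ))) (vs-vertex (suc ℓ) ℕP.≤-refl) s≢t))
  below : AllVertices (_≤ s) (parallelClass (s , t) d)
  below = parallelClass-vertices s t d ℕP.≤-refl (ℕP.<⇒≤ (vs-decreasing ℓ (s≤s (ℕP.n≤1+n ℓ))))

corollary2p7 : (m : ℕ) → 2 ≤ m → (π : List ℕ) → IsPartition m π → (d : ℕ) →
    DegreeOfDegeneracy (qQ (stdQuiver m π d)) d
corollary2p7 m 2≤m []                (_ , _ , 0≡m) d = ⊥-elim (ℕP.<-irrefl 0≡m (ℕP.<-trans (s≤s z≤n) 2≤m))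
corollary2p7 .(suc (suc k)) (s≤s (s≤s {n = k} _)) (p ∷ []) _ d = degeneracy-onePart k p d
corollary2p7 m 2≤m (p₁ ∷ p₂ ∷ π) partition d = degeneracy-severalParts m p₁ p₂ π d 2≤m partition
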